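{- Let $G=(V,E)$ be a finite graph (parallel edges allowed, no loops) and let $\widehat{G}$ be the graph constructed from $G$ as follows. Let $M:=3|V|+2|E|+2$. The nodes of $\widehat{G}$ are: a single node $T$; for every $v\in V$ three nodes $v,v',T_v$; and for every edge $e\in E$ with ends $u,v$ two nodes $e_u$ and $e_v$. The edges of $\widehat{G}$ are: for every edge $e\in E$ with ends $u,v$, one edge between $e_u$ and $e_v$, $M$ parallel edges between $u$ and $e_u$, and $M$ parallel edges between $e_v$ and $v$; for every $v\in V$, three parallel edges between $v'$ and $T_v$, $M$ parallel edges between $v$ and $v'$, and $M$ parallel edges between $T_v$ and $T$. Then $$\operatorname{dgon}(\widehat{G})=4|V|+|E|+1-\alpha(G),$$ where $\alpha(G)$ is the maximum size of an independent set of $G$.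
   Context: For a finite connected graph $H=(W,F)$ (parallel edges allowed, no loops), the Laplacian $Q(H)\in\mathbb{Z}^{W\times W}$ has $Q(H)_{uu}=\deg(u)$ and $Q(H)_{uv}=-(\text{number of edges between }u\text{ and }v)$ for $u\neq v$. A divisor is a vector $D\in\mathbb{Z}^W$ with degree $\deg(D)=\sum_{w}D(w)$; it is effective if $D\ge0$. $D\sim D'$ if $D-D'=Q(H)x$ for some $x\in\mathbb{Z}^W$. If $D$ is equivalent to an effective divisor, $\operatorname{rank}(D)$ is the largest $k$ such that $D-E$ is equivalent to an effective divisor for every effective divisor $E$ of degree at most $k$; otherwise $\operatorname{rank}(D)=-1$. The gonality is $\operatorname{dgon}(H)=\min\{\deg(D)\mid\operatorname{rank}(D)\ge1\}$. (The graph $\widehat G$ is connected.) -}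

module Defs where

open import Data.Nat as ℕ using (ℕ; zero; suc)
open import Data.Integer as ℤ using (ℤ; +_; _-_; _*_; _≤_)
open import Data.Fin using (Fin; zero; suc; _↑ˡ_; _↑ʳ_; _≟_)
open import Data.Fin.Subset using (Subset; _∈_; ∣_∣)
open import Data.List using (List; []; _∷_; _++_; replicate; concatMap; allFin; foldr)
open import Data.Product using (Σ; _×_; _,_; proj₁; proj₂; ∃)
open import Relation.Nullary using (¬_; does)
open import Relation.Binary.PropositionalEquality using (_≡_)
open import Data.Bool using (if_then_else_; _∨_; _∧_)

record MultiGraph : Set where
  field
    N     : ℕ
    edges : List (Fin N × Fin N)
open MultiGraph public

Σℤ : ∀ {N} → (Fin N → ℤ) → ℤ
Σℤ {zero}  f = + 0
Σℤ {suc N} f = f zero ℤ.+ Σℤ (λ i → f (suc i))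

ind : Data.Bool.Bool → ℕ
ind b = if b then 1 else 0

mult : (H : MultiGraph) → Fin (N H) → Fin (N H) → ℕ
mult H u v = foldr (λ e acc → ind ((does (proj₁ e ≟ u) ∧ does (proj₂ e ≟ v))
                                   ∨ (does (proj₁ e ≟ v) ∧ does (proj₂ e ≟ u))) ℕ.+ acc)
                   0 (edges H)

degree : (H : MultiGraph) → Fin (N H) → ℕ
degree H u = foldr (λ e acc → ind (does (proj₁ e ≟ u)) ℕ.+ ind (does (proj₂ e ≟ u)) ℕ.+ acc)
                   0 (edges H)

Lap : (H : MultiGraph) → Fin (N H) → Fin (N H) → ℤ
Lap H u v = if does (u ≟ v) then + degree H u else ℤ.- (+ mult H u v)

Divisor : MultiGraph → Set
Divisor H = Fin (N H) → ℤ

deg : {H : MultiGraph} → Divisor H → ℤ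
deg D = Σℤ D

Effective : {H : MultiGraph} → Divisor H → Set
Effective D = ∀ w → + 0 ≤ D w

LinEquiv : (H : MultiGraph) → Divisor H → Divisor H → Set
LinEquiv H D D' = ∃ λ (x : Fin (N H) → ℤ) → ∀ u → D u - D' u ≡ Σℤ (λ v → Lap H u v * x v)

EquivEffective : (H : MultiGraph) → Divisor H → Set
EquivEffective H D = ∃ λ (F : Divisor H) → Effective {H} F × LinEquiv H D F

RankAtLeast : (H : MultiGraph) → Divisor H → ℕ → Set
RankAtLeast H D k = ∀ (E : Divisor H) → Effective {H} E → deg {H} E ≤ + k →
                    EquivEffective H (λ w → D w - E w)

IsGonality : (H : MultiGraph) → ℤ → Set
IsGonality H g =
  (∃ λ (D : Divisor H) → RankAtLeast H D 1 × deg {H} D ≡ g)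
  × (∀ (D : Divisor H) → RankAtLeast H D 1 → g ≤ deg {H} D)

Independent : ∀ {n m} → (Fin m → Fin n × Fin n) → Subset n → Set
Independent ends S = ∀ e → ¬ (proj₁ (ends e) ∈ S × proj₂ (ends e) ∈ S)

IsIndependenceNumber : ∀ {n m} → (Fin m → Fin n × Fin n) → ℕ → Set
IsIndependenceNumber {n} ends a =
  (∃ λ (S : Subset n) → Independent ends S × ∣ S ∣ ≡ a)
  × (∀ (S : Subset n) → Independent ends S → ∣ S ∣ ℕ.≤ a)

-- The construction Ĝ. Nodes: T, v, v', T_v (v ∈ V), e_u, e_v (e ∈ E).
-- For e with ends (u , v): e_u = first end-node, e_v = second end-node.

hatN : ℕ → ℕ → ℕ
hatN n m = suc (n ℕ.+ (n ℕ.+ (n ℕ.+ (m ℕ.+ m))))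

module Hat (n m : ℕ) where
  nT : Fin (hatN n m)
  nT = zero
  nV : Fin n → Fin (hatN n m)
  nV v = suc (v ↑ˡ (n ℕ.+ (n ℕ.+ (m ℕ.+ m))))
  nV' : Fin n → Fin (hatN n m)
  nV' v = suc (n ↑ʳ (v ↑ˡ (n ℕ.+ (m ℕ.+ m))))
  nTv : Fin n → Fin (hatN n m)
  nTv v = suc (n ↑ʳ n ↑ʳ (v ↑ˡ (m ℕ.+ m)))
  nE₁ : Fin m → Fin (hatN n m)
  nE₁ e = suc (n ↑ʳ n ↑ʳ n ↑ʳ (e ↑ˡ m))
  nE₂ : Fin m → Fin (hatN n m)
  nE₂ e = suc (n ↑ʳ n ↑ʳ n ↑ʳ m ↑ʳ e)

hat : (n m : ℕ) → (Fin m → Fin n × Fin n) → MultiGraph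
hat n m ends = record { N = hatN n m ; edges = edgeEdges ++ vertexEdges }
  where
  open Hat n m
  M : ℕ
  M = 3 ℕ.* n ℕ.+ 2 ℕ.* m ℕ.+ 2
  edgeEdges = concatMap (λ e →
      (nE₁ e , nE₂ e) ∷ replicate M (nV (proj₁ (ends e)) , nE₁ e)
                       ++ replicate M (nE₂ e , nV (proj₂ (ends e))))
    (allFin m)
  vertexEdges = concatMap (λ v →
      replicate 3 (nV' v , nTv v) ++ replicate M (nV v , nV' v)
                                  ++ replicate M (nTv v , nT))
    (allFin n)

-- Upper bound: fix a maximum independent set I and orient G acyclically, every edge meeting I
-- pointing into I. Put one chip on T and on every v, one chip on v′ and on Tᵥ for v ∈ I and three
-- chips on v′ for v ∉ I, and one chip on each edge gadget, at the side of the tail of the edge.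
-- This divisor has degree 4|V| + |E| + 1 - α, and it has rank 1: for every node q, firing an
-- initial segment of V ∖ I (each v together with v′ and every e_v) yields an equivalent
-- effective divisor with a chip on q.
--
-- Lower bound: let D have rank 1, F₀ ~ D effective, and F₀ - χ_q - F_q = Q x_q with F_q effective
-- for each node q. If deg F₀ ≥ M we are done, since M ≥ 4|V| + |E| + 1 - α. Otherwise x_q is
-- constant across each bundle of M parallel edges, because a cut along a level set of x_q through
-- such a bundle would have weight ≥ M > deg F₀. Then Q x_q is explicit, and F₀ ≥ χ_q + Q x_q
-- gives F₀(T), F₀(v) ≥ 1; F₀(v′) + F₀(Tᵥ) ≥ 3 unless v is light (that sum is 2); and
-- F₀(e_u) + F₀(e_v) ≥ 1, and ≥ 2 if both ends of e are light. As a set L of light vertices spans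
-- at least |L| - α edges, deg F₀ ≥ 4|V| + |E| + 1 - α.

module Submission where

open import Defs

module Gonality where

  open import Data.Nat as ℕ using (ℕ; zero; suc)
  import Data.Nat.Properties as ℕ
  open import Data.Integer as ℤ using (ℤ; +_; _+_; _-_; _*_; -_; _≤_; _<_)
  import Data.Integer.Properties as ℤ
  open import Data.Integer.Tactic.RingSolver using (solve-∀)
  open import Data.Fin using (Fin; zero; suc; _≟_; _↑ˡ_; _↑ʳ_; splitAt)
  import Data.Fin.Properties as Fin
  open import Data.Fin.Properties using (splitAt-↑ˡ; splitAt-↑ʳ; splitAt⁻¹-↑ˡ; splitAt⁻¹-↑ʳ)
  open import Data.Fin.Subset using (Subset; _∈_; ∣_∣)
  open import Data.Vec as Vec using ([]; _∷_; lookup)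
  open import Data.Vec.Properties using (lookup∘tabulate; []=⇒lookup; lookup⇒[]=)
  open import Data.Bool using (Bool; true; false; if_then_else_; _∧_; _∨_; not)
  import Data.Bool.Properties as Bool
  open import Data.List using (List; []; _∷_; _++_; map; replicate; concatMap; tabulate; allFin; foldr)
  open import Data.List.Relation.Unary.All using (All; []; _∷_)
  open import Data.List.Relation.Unary.All.Properties using (++⁺; concat⁺; map⁺; tabulate⁺; replicate⁺)
  open import Data.Sum using (inj₁; inj₂; [_,_]′)
  open import Data.Product using (_×_; _,_; proj₁; proj₂; ∃)
  open import Data.Empty using (⊥; ⊥-elim)
  open import Function using (_∘_)
  open import Relation.Nullary using (¬_; Dec; does; yes; no)
  open import Relation.Nullary.Decidable using (_×-dec_; dec-true; dec-false)
  open import Relation.Binary.Definitions using (tri<; tri≈; tri>)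
  open import Relation.Binary.PropositionalEquality

  ≤-by-slack : ∀ {i k} j → + 0 ≤ j → i + j ≡ k → i ≤ k
  ≤-by-slack {i} j 0≤j refl = ℤ.i≤i+j i j {{ℤ.nonNegative 0≤j}}

  i<j⇒1≤j-i : ∀ {i j} → i < j → + 1 ≤ j - i
  i<j⇒1≤j-i {i} {j} i<j = ≤-by-slack (j - ℤ.suc i) (ℤ.i≤j⇒0≤j-i (ℤ.i<j⇒suc[i]≤j i<j)) (slack i j)
    where
    slack : ∀ i j → + 1 + (j - (+ 1 + i)) ≡ j - i
    slack = solve-∀

  private
    3*suc≰2 : ∀ k → ¬ 3 ℕ.* suc k ℕ.≤ 2
    3*suc≰2 k 3k≤2 with ℕ.≤-trans (ℕ.*-monoʳ-≤ 3 (ℕ.s≤s (ℕ.z≤n {k}))) 3k≤2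
    ... | ℕ.s≤s (ℕ.s≤s ())

  3*i≤2⇒3*-i≤2⇒i≡0 : ∀ i → + 3 * i ≤ + 2 → + 3 * (- i) ≤ + 2 → i ≡ + 0
  3*i≤2⇒3*-i≤2⇒i≡0 (+ zero)      _     _      = refl
  3*i≤2⇒3*-i≤2⇒i≡0 (+ suc k)     3i≤2  _      = ⊥-elim (3*suc≰2 k (ℤ.drop‿+≤+ 3i≤2))
  3*i≤2⇒3*-i≤2⇒i≡0 ℤ.-[1+ k ]   _     3-i≤2  = ⊥-elim (3*suc≰2 k (ℤ.drop‿+≤+ 3-i≤2))

  *-distribʳ-minus : ∀ i j k → (i - j) * k ≡ i * k - j * k
  *-distribʳ-minus = solve-∀

  *-distribˡ-minus : ∀ i j k → i * (j - k) ≡ i * j - i * k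
  *-distribˡ-minus = solve-∀

  Σℤ-cong : ∀ {N} {f g : Fin N → ℤ} → (∀ i → f i ≡ g i) → Σℤ f ≡ Σℤ g
  Σℤ-cong {zero}  f≗g = refl
  Σℤ-cong {suc N} f≗g = cong₂ _+_ (f≗g zero) (Σℤ-cong (λ i → f≗g (suc i)))

  Σℤ-zero : ∀ N → Σℤ {N} (λ _ → + 0) ≡ + 0
  Σℤ-zero zero    = refl
  Σℤ-zero (suc N) = trans (ℤ.+-identityˡ _) (Σℤ-zero N)

  Σℤ-const : ∀ N c → Σℤ {N} (λ _ → + c) ≡ + (N ℕ.* c)
  Σℤ-const zero    c = refl
  Σℤ-const (suc N) c = cong (_+_ (+ c)) (Σℤ-const N c)

  Σℤ-1 : ∀ N → Σℤ {N} (λ _ → + 1) ≡ + N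
  Σℤ-1 N = trans (Σℤ-const N 1) (cong +_ (ℕ.*-identityʳ N))

  Σℤ-+ : ∀ {N} (f g : Fin N → ℤ) → Σℤ (λ i → f i + g i) ≡ Σℤ f + Σℤ g
  Σℤ-+ {zero}  f g = refl
  Σℤ-+ {suc N} f g = trans (cong (_+_ (f zero + g zero)) (Σℤ-+ (λ i → f (suc i)) (λ i → g (suc i))))
                           (interchange (f zero) (g zero) _ _)
    where
    interchange : ∀ a b c d → a + b + (c + d) ≡ a + c + (b + d)
    interchange = solve-∀

  Σℤ-*ˡ : ∀ {N} c (f : Fin N → ℤ) → Σℤ (λ i → c * f i) ≡ c * Σℤ f
  Σℤ-*ˡ {zero}  c f = sym (ℤ.*-zeroʳ c)
  Σℤ-*ˡ {suc N} c f = trans (cong (_+_ (c * f zero)) (Σℤ-*ˡ c (λ i → f (suc i))))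
                            (sym (ℤ.*-distribˡ-+ c (f zero) _))

  Σℤ-neg : ∀ {N} (f : Fin N → ℤ) → Σℤ (λ i → - f i) ≡ - Σℤ f
  Σℤ-neg f = trans (Σℤ-cong (λ i → sym (ℤ.-1*i≡-i (f i)))) (trans (Σℤ-*ˡ (- + 1) f) (ℤ.-1*i≡-i (Σℤ f)))

  Σℤ-- : ∀ {N} (f g : Fin N → ℤ) → Σℤ (λ i → f i - g i) ≡ Σℤ f - Σℤ g
  Σℤ-- f g = trans (Σℤ-+ f (λ i → - g i)) (cong (_+_ (Σℤ f)) (Σℤ-neg g))

  Σℤ-mono-≤ : ∀ {N} {f g : Fin N → ℤ} → (∀ i → f i ≤ g i) → Σℤ f ≤ Σℤ g
  Σℤ-mono-≤ {zero}  f≤g = ℤ.≤-refl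
  Σℤ-mono-≤ {suc N} f≤g = ℤ.+-mono-≤ (f≤g zero) (Σℤ-mono-≤ (λ i → f≤g (suc i)))

  Σℤ-nonneg : ∀ {N} {f : Fin N → ℤ} → (∀ i → + 0 ≤ f i) → + 0 ≤ Σℤ f
  Σℤ-nonneg {N} {f} 0≤f = subst (_≤ Σℤ f) (Σℤ-zero N) (Σℤ-mono-≤ 0≤f)

  term≤Σℤ : ∀ {N} {f : Fin N → ℤ} → (∀ i → + 0 ≤ f i) → ∀ a → f a ≤ Σℤ f
  term≤Σℤ {suc N} {f} 0≤f zero    = ≤-by-slack _ (Σℤ-nonneg (λ i → 0≤f (suc i))) refl
  term≤Σℤ {suc N} {f} 0≤f (suc a) =
    ℤ.i≤j⇒i≤k+j (f zero) {{ℤ.nonNegative (0≤f zero)}} (term≤Σℤ (λ i → 0≤f (suc i)) a)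

  two-terms≤Σℤ : ∀ {N} {f : Fin N → ℤ} → (∀ i → + 0 ≤ f i) → ∀ a b → ¬ a ≡ b → f a + f b ≤ Σℤ f
  two-terms≤Σℤ 0≤f zero zero a≢b = ⊥-elim (a≢b refl)
  two-terms≤Σℤ {suc N} {f} 0≤f zero (suc b) _ = ℤ.+-monoʳ-≤ (f zero) (term≤Σℤ (λ i → 0≤f (suc i)) b)
  two-terms≤Σℤ {suc N} {f} 0≤f (suc a) zero _ =
    subst (_≤ Σℤ f) (ℤ.+-comm (f zero) (f (suc a))) (ℤ.+-monoʳ-≤ (f zero) (term≤Σℤ (λ i → 0≤f (suc i)) a))
  two-terms≤Σℤ {suc N} {f} 0≤f (suc a) (suc b) a≢b =
    ℤ.i≤j⇒i≤k+j (f zero) {{ℤ.nonNegative (0≤f zero)}}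
      (two-terms≤Σℤ (λ i → 0≤f (suc i)) a b (λ a≡b → a≢b (cong suc a≡b)))

  Σℤ-indicator : ∀ {N} (a : Fin N) (f : Fin N → ℤ) → Σℤ (λ i → if does (a ≟ i) then f i else + 0) ≡ f a
  Σℤ-indicator {suc N} zero    f = trans (cong (_+_ (f zero)) (Σℤ-zero N)) (ℤ.+-identityʳ (f zero))
  Σℤ-indicator {suc N} (suc a) f = trans (ℤ.+-identityˡ _) (Σℤ-indicator a (λ i → f (suc i)))

  indicator : ∀ {K} → Fin K → Fin K → ℤ
  indicator a u = + ind (does (a ≟ u))

  module _ {K : ℕ} where

    indicator-* : ∀ (a u : Fin K) y → indicator a u * y ≡ (if does (a ≟ u) then y else + 0)
    indicator-* a u y with does (a ≟ u)
    ... | true  = ℤ.*-identityˡ y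
    ... | false = ℤ.*-zeroˡ y

    indicator≥0 : ∀ (q u : Fin K) → + 0 ≤ indicator q u
    indicator≥0 q u = ℤ.+≤+ ℕ.z≤n

    deg-indicator : ∀ (q : Fin K) → Σℤ (indicator q) ≡ + 1
    deg-indicator q = trans (Σℤ-cong (λ u → trans (sym (ℤ.*-identityʳ _)) (indicator-* q u (+ 1))))
                            (Σℤ-indicator q (λ _ → + 1))

    indicator-self : ∀ (q : Fin K) → indicator q q ≡ + 1
    indicator-self q with q ≟ q
    ... | yes _   = refl
    ... | no q≢q  = ⊥-elim (q≢q refl)

  module _ {k K : ℕ} (h : Fin k → Fin K) where

    Σℤ-indicator-outside : ∀ u → (∀ i → ¬ h i ≡ u) → (c : Fin k → ℤ) → Σℤ (λ i → indicator (h i) u * c i) ≡ + 0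
    Σℤ-indicator-outside u h≢u c = trans (Σℤ-cong vanish) (Σℤ-zero k)
      where
      vanish : ∀ i → indicator (h i) u * c i ≡ + 0
      vanish i with h i ≟ u
      ... | yes hi≡u = ⊥-elim (h≢u i hi≡u)
      ... | no _     = ℤ.*-zeroˡ (c i)

    Σℤ-indicator-injective : (∀ {i j} → h i ≡ h j → i ≡ j) → ∀ i₀ (c : Fin k → ℤ) →
                             Σℤ (λ i → indicator (h i) (h i₀) * c i) ≡ c i₀
    Σℤ-indicator-injective injective i₀ c = trans (Σℤ-cong reindex) (Σℤ-indicator i₀ c)
      where
      reindex : ∀ i → indicator (h i) (h i₀) * c i ≡ (if does (i₀ ≟ i) then c i else + 0)
      reindex i with h i ≟ h i₀ | i₀ ≟ i
      ... | yes _  | yes _  = ℤ.*-identityˡ (c i)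
      ... | no _   | no _   = ℤ.*-zeroˡ (c i)
      ... | yes hi≡hi₀ | no i₀≢i = ⊥-elim (i₀≢i (sym (injective hi≡hi₀)))
      ... | no hi≢hi₀  | yes refl = ⊥-elim (hi≢hi₀ refl)

  Σℤ-↑ : ∀ a b (f : Fin (a ℕ.+ b) → ℤ) → Σℤ f ≡ Σℤ (λ i → f (i ↑ˡ b)) + Σℤ (λ j → f (a ↑ʳ j))
  Σℤ-↑ zero    b f = sym (ℤ.+-identityˡ _)
  Σℤ-↑ (suc a) b f = trans (cong (_+_ (f zero)) (Σℤ-↑ a b (λ i → f (suc i)))) (sym (ℤ.+-assoc (f zero) _ _))

  Σℤ-swap : ∀ {a b} (f : Fin a → Fin b → ℤ) → Σℤ (λ i → Σℤ (f i)) ≡ Σℤ (λ j → Σℤ (λ i → f i j))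
  Σℤ-swap {zero}  {b} f = sym (Σℤ-zero b)
  Σℤ-swap {suc a} {b} f = trans (cong (_+_ (Σℤ (f zero))) (Σℤ-swap (λ i → f (suc i))))
                                (sym (Σℤ-+ (f zero) (λ j → Σℤ (λ i → f (suc i) j))))

  Σℤ-∣∣ : ∀ {N} (S : Subset N) → Σℤ (λ i → + ind (lookup S i)) ≡ + ∣ S ∣
  Σℤ-∣∣ []          = refl
  Σℤ-∣∣ (true ∷ S)  = cong (_+_ (+ 1)) (Σℤ-∣∣ S)
  Σℤ-∣∣ (false ∷ S) = trans (ℤ.+-identityˡ _) (Σℤ-∣∣ S)

  sumℤ : List ℤ → ℤ
  sumℤ = foldr _+_ (+ 0)

  module _ {A : Set} (f : A → ℤ) where

    sumℤ-++ : ∀ xs ys → sumℤ (map f (xs ++ ys)) ≡ sumℤ (map f xs) + sumℤ (map f ys)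
    sumℤ-++ []       ys = sym (ℤ.+-identityˡ _)
    sumℤ-++ (x ∷ xs) ys = trans (cong (_+_ (f x)) (sumℤ-++ xs ys)) (sym (ℤ.+-assoc (f x) _ _))

    sumℤ-concatMap : ∀ {B : Set} {k} (g : B → List A) (h : Fin k → B) →
                     sumℤ (map f (concatMap g (tabulate h))) ≡ Σℤ (λ i → sumℤ (map f (g (h i))))
    sumℤ-concatMap {k = zero}  g h = refl
    sumℤ-concatMap {k = suc k} g h = trans (sumℤ-++ (g (h zero)) _)
                                           (cong (_+_ (sumℤ (map f (g (h zero))))) (sumℤ-concatMap g (λ i → h (suc i))))

    sumℤ-replicate : ∀ k x → sumℤ (map f (replicate k x)) ≡ + k * f x
    sumℤ-replicate zero    x = sym (ℤ.*-zeroˡ (f x))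
    sumℤ-replicate (suc k) x = trans (cong (_+_ (f x)) (sumℤ-replicate k x)) (sym (ℤ.suc-* (+ k) (f x)))

    sumℤ-nonneg : (∀ x → + 0 ≤ f x) → ∀ xs → + 0 ≤ sumℤ (map f xs)
    sumℤ-nonneg 0≤f []       = ℤ.≤-refl
    sumℤ-nonneg 0≤f (x ∷ xs) = ℤ.+-mono-≤ (0≤f x) (sumℤ-nonneg 0≤f xs)

    sumℤ-zero : (∀ x → f x ≡ + 0) → ∀ xs → sumℤ (map f xs) ≡ + 0
    sumℤ-zero f≡0 []       = refl
    sumℤ-zero f≡0 (x ∷ xs) = cong₂ _+_ (f≡0 x) (sumℤ-zero f≡0 xs)

  -- Sub-multiset inclusion, witnessed through every nonnegative weighting.
  record _⊑_ {A : Set} (xs ys : List A) : Set where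
    constructor weighted
    field
      sumℤ-mono : ∀ (g : A → ℤ) → (∀ x → + 0 ≤ g x) → sumℤ (map g xs) ≤ sumℤ (map g ys)
  open _⊑_ public

  module _ {A : Set} where

    ⊑-trans : {xs ys zs : List A} → xs ⊑ ys → ys ⊑ zs → xs ⊑ zs
    ⊑-trans xs⊑ys ys⊑zs = weighted λ g g≥0 → ℤ.≤-trans (sumℤ-mono xs⊑ys g g≥0) (sumℤ-mono ys⊑zs g g≥0)

    xs⊑xs++ys : (xs ys : List A) → xs ⊑ (xs ++ ys)
    xs⊑xs++ys xs ys = weighted λ g g≥0 → ≤-by-slack _ (sumℤ-nonneg g g≥0 ys) (sym (sumℤ-++ g xs ys))

    ys⊑xs++ys : (xs ys : List A) → ys ⊑ (xs ++ ys)
    ys⊑xs++ys xs ys = weighted λ g g≥0 → ≤-by-slack _ (sumℤ-nonneg g g≥0 xs)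
      (trans (ℤ.+-comm (sumℤ (map g ys)) _) (sym (sumℤ-++ g xs ys)))

    ⊑-concatMap : ∀ {k} (f : Fin k → List A) i → f i ⊑ concatMap f (allFin k)
    ⊑-concatMap f i = weighted λ g g≥0 → subst (sumℤ (map g (f i)) ≤_) (sym (sumℤ-concatMap g f (λ j → j)))
      (term≤Σℤ (λ j → sumℤ-nonneg g g≥0 (f j)) i)

  laplace : (H : MultiGraph) → (Fin (N H) → ℤ) → Divisor H
  laplace H x u = Σℤ (λ v → Lap H u v * x v)

  Loopless : MultiGraph → Set
  Loopless H = All (λ e → ¬ proj₁ e ≡ proj₂ e) (edges H)

  graphOf : ∀ {K} → List (Fin K × Fin K) → MultiGraph
  graphOf {K} L = record { N = K ; edges = L }

  incidence : ∀ {K} → Fin K × Fin K → Fin K → ℤ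
  incidence (a , b) u = indicator a u - indicator b u

  outflow : ∀ {K} → (Fin K → ℤ) → Fin K → Fin K × Fin K → ℤ
  outflow x u (a , b) = incidence (a , b) u * (x a - x b)

  -- The Dirichlet form  wᵀ Q x  splits into these edge terms.
  dirichlet : ∀ {K} → (Fin K → ℤ) → (Fin K → ℤ) → Fin K × Fin K → ℤ
  dirichlet w x (a , b) = (w a - w b) * (x a - x b)

  module _ {K : ℕ} where

    Σℤ-incidence : ∀ e (f : Fin K → ℤ) → Σℤ (λ u → incidence e u * f u) ≡ f (proj₁ e) - f (proj₂ e)
    Σℤ-incidence (a , b) f = begin
      Σℤ (λ u → incidence (a , b) u * f u)
        ≡⟨ Σℤ-cong (λ u → *-distribʳ-minus (indicator a u) (indicator b u) (f u)) ⟩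
      Σℤ (λ u → indicator a u * f u - indicator b u * f u)
        ≡⟨ Σℤ-- {K} _ _ ⟩
      Σℤ (λ u → indicator a u * f u) - Σℤ (λ u → indicator b u * f u)
        ≡⟨ cong₂ _-_ (Σℤ-cong (λ u → indicator-* a u (f u))) (Σℤ-cong (λ u → indicator-* b u (f u))) ⟩
      Σℤ (λ u → if does (a ≟ u) then f u else + 0) - Σℤ (λ u → if does (b ≟ u) then f u else + 0)
        ≡⟨ cong₂ _-_ (Σℤ-indicator a f) (Σℤ-indicator b f) ⟩
      f a - f b ∎
      where open ≡-Reasoning

    Lap-single : ∀ {a b : Fin K} → ¬ a ≡ b → ∀ u v →
                 Lap (graphOf ((a , b) ∷ [])) u v ≡ incidence (a , b) u * incidence (a , b) v
    Lap-single {a} {b} a≢b u v with u ≟ v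
    ... | yes refl with a ≟ u | b ≟ u
    ...   | yes refl | yes refl = ⊥-elim (a≢b refl)
    ...   | yes _    | no _     = refl
    ...   | no _     | yes _    = refl
    ...   | no _     | no _     = refl
    Lap-single {a} {b} a≢b u v | no u≢v with a ≟ u | b ≟ u | a ≟ v | b ≟ v
    ... | yes refl | yes refl | _ | _ = ⊥-elim (a≢b refl)
    ... | _ | _ | yes refl | yes refl = ⊥-elim (a≢b refl)
    ... | yes refl | _ | yes refl | _ = ⊥-elim (u≢v refl)
    ... | _ | yes refl | _ | yes refl = ⊥-elim (u≢v refl)
    ... | yes _ | no _ | no _ | yes _ = refl
    ... | yes _ | no _ | no _ | no _  = refl
    ... | no _ | yes _ | yes _ | no _ = refl
    ... | no _ | yes _ | no _ | no _  = refl
    ... | no _ | no _ | yes _ | no _  = refl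
    ... | no _ | no _ | no _ | yes _  = refl
    ... | no _ | no _ | no _ | no _   = refl

    Lap-∷ : ∀ e (L : List (Fin K × Fin K)) u v →
            Lap (graphOf (e ∷ L)) u v ≡ Lap (graphOf (e ∷ [])) u v + Lap (graphOf L) u v
    Lap-∷ e L u v with does (u ≟ v)
    ... | true  = cong +_ (cong (ℕ._+ degree (graphOf L) u) (sym (ℕ.+-identityʳ _)))
    ... | false = trans (cong (λ k → - + k) (cong (ℕ._+ mult (graphOf L) u v) (sym (ℕ.+-identityʳ _))))
                        (ℤ.neg-distrib-+ (+ _) (+ mult (graphOf L) u v))

    Lap-[] : ∀ u v → Lap (graphOf {K} []) u v ≡ + 0
    Lap-[] u v with does (u ≟ v)
    ... | true  = refl
    ... | false = refl

    laplace-single : ∀ {a b : Fin K} → ¬ a ≡ b → ∀ x u → laplace (graphOf ((a , b) ∷ [])) x u ≡ outflow x u (a , b)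
    laplace-single {a} {b} a≢b x u = begin
      Σℤ (λ v → Lap (graphOf ((a , b) ∷ [])) u v * x v)
        ≡⟨ Σℤ-cong (λ v → trans (cong (_* x v) (Lap-single a≢b u v)) (ℤ.*-assoc (incidence (a , b) u) _ _)) ⟩
      Σℤ (λ v → incidence (a , b) u * (incidence (a , b) v * x v))
        ≡⟨ Σℤ-*ˡ {K} (incidence (a , b) u) _ ⟩
      incidence (a , b) u * Σℤ (λ v → incidence (a , b) v * x v)
        ≡⟨ cong (incidence (a , b) u *_) (Σℤ-incidence (a , b) x) ⟩
      outflow x u (a , b) ∎
      where open ≡-Reasoning

    laplace-graphOf : ∀ (L : List (Fin K × Fin K)) → Loopless (graphOf L) → ∀ x u →
                      laplace (graphOf L) x u ≡ sumℤ (map (outflow x u) L)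
    laplace-graphOf [] _ x u = trans (Σℤ-cong (λ v → cong (_* x v) (Lap-[] u v))) (Σℤ-zero K)
    laplace-graphOf ((a , b) ∷ L) (a≢b ∷ loopless) x u = begin
      Σℤ (λ v → Lap (graphOf ((a , b) ∷ L)) u v * x v)
        ≡⟨ Σℤ-cong (λ v → trans (cong (_* x v) (Lap-∷ (a , b) L u v))
                                (ℤ.*-distribʳ-+ (x v) (Lap (graphOf ((a , b) ∷ [])) u v) (Lap (graphOf L) u v))) ⟩
      Σℤ (λ v → Lap (graphOf ((a , b) ∷ [])) u v * x v + Lap (graphOf L) u v * x v)
        ≡⟨ Σℤ-+ {K} _ _ ⟩
      laplace (graphOf ((a , b) ∷ [])) x u + laplace (graphOf L) x u
        ≡⟨ cong₂ _+_ (laplace-single a≢b x u) (laplace-graphOf L loopless x u) ⟩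
      outflow x u (a , b) + sumℤ (map (outflow x u) L) ∎
      where open ≡-Reasoning

    Σℤ-*-outflow : ∀ (L : List (Fin K × Fin K)) (w x : Fin K → ℤ) →
                   Σℤ (λ u → w u * sumℤ (map (outflow x u) L)) ≡ sumℤ (map (dirichlet w x) L)
    Σℤ-*-outflow [] w x = trans (Σℤ-cong (λ u → ℤ.*-zeroʳ (w u))) (Σℤ-zero K)
    Σℤ-*-outflow ((a , b) ∷ L) w x = begin
      Σℤ (λ u → w u * (outflow x u (a , b) + sumℤ (map (outflow x u) L)))
        ≡⟨ Σℤ-cong (λ u → ℤ.*-distribˡ-+ (w u) _ _) ⟩
      Σℤ (λ u → w u * outflow x u (a , b) + w u * sumℤ (map (outflow x u) L))
        ≡⟨ Σℤ-+ {K} _ _ ⟩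
      Σℤ (λ u → w u * outflow x u (a , b)) + Σℤ (λ u → w u * sumℤ (map (outflow x u) L))
        ≡⟨ cong₂ _+_ edge-term (Σℤ-*-outflow L w x) ⟩
      dirichlet w x (a , b) + sumℤ (map (dirichlet w x) L) ∎
      where
      open ≡-Reasoning
      rearrange : ∀ w s d → w * (s * d) ≡ s * (w * d)
      rearrange = solve-∀
      factor : ∀ wa wb d → wa * d - wb * d ≡ (wa - wb) * d
      factor = solve-∀
      edge-term : Σℤ (λ u → w u * outflow x u (a , b)) ≡ dirichlet w x (a , b)
      edge-term = trans (Σℤ-cong (λ u → rearrange (w u) (incidence (a , b) u) (x a - x b)))
                        (trans (Σℤ-incidence (a , b) (λ u → w u * (x a - x b))) (factor (w a) (w b) (x a - x b)))

  module _ (H : MultiGraph) (loopless : Loopless H) where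

    laplace-outflow : ∀ x u → laplace H x u ≡ sumℤ (map (outflow x u) (edges H))
    laplace-outflow = laplace-graphOf (edges H) loopless

    Σℤ-*-laplace : ∀ w x → Σℤ (λ u → w u * laplace H x u) ≡ sumℤ (map (dirichlet w x) (edges H))
    Σℤ-*-laplace w x = trans (Σℤ-cong (λ u → cong (w u *_) (laplace-outflow x u))) (Σℤ-*-outflow (edges H) w x)

    deg-laplace : ∀ x → Σℤ (laplace H x) ≡ + 0
    deg-laplace x = begin
      Σℤ (laplace H x)                               ≡⟨ Σℤ-cong (λ u → sym (ℤ.*-identityˡ (laplace H x u))) ⟩
      Σℤ (λ u → + 1 * laplace H x u)                 ≡⟨ Σℤ-*-laplace (λ _ → + 1) x ⟩
      sumℤ (map (dirichlet (λ _ → + 1) x) (edges H)) ≡⟨ sumℤ-zero _ (λ (a , b) → ℤ.*-zeroˡ (x a - x b)) (edges H) ⟩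
      + 0 ∎
      where open ≡-Reasoning

  laplace-- : ∀ (H : MultiGraph) x y u → laplace H (λ v → x v - y v) u ≡ laplace H x u - laplace H y u
  laplace-- H x y u = trans (Σℤ-cong (λ v → *-distribˡ-minus (Lap H u v) (x v) (y v))) (Σℤ-- {N H} _ _)

  module _ {k K : ℕ} (h₁ h₂ : Fin k → Fin K) (x : Fin K → ℤ) where

    private
      d : Fin k → ℤ
      d i = x (h₁ i) - x (h₂ i)

    Σℤ-outflow-split : ∀ u → Σℤ (λ i → outflow x u (h₁ i , h₂ i)) ≡
                       Σℤ (λ i → indicator (h₁ i) u * d i) - Σℤ (λ i → indicator (h₂ i) u * d i)
    Σℤ-outflow-split u =
      trans (Σℤ-cong (λ i → *-distribʳ-minus (indicator (h₁ i) u) (indicator (h₂ i) u) (d i))) (Σℤ-- {k} _ _)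

    Σℤ-outflow-source : (∀ {i j} → h₁ i ≡ h₁ j → i ≡ j) → ∀ i₀ → (∀ i → ¬ h₂ i ≡ h₁ i₀) →
                        Σℤ (λ i → outflow x (h₁ i₀) (h₁ i , h₂ i)) ≡ x (h₁ i₀) - x (h₂ i₀)
    Σℤ-outflow-source injective i₀ h₂≢ = trans (Σℤ-outflow-split (h₁ i₀))
      (trans (cong₂ _-_ (Σℤ-indicator-injective h₁ injective i₀ d) (Σℤ-indicator-outside h₂ (h₁ i₀) h₂≢ d))
             (ℤ.+-identityʳ (d i₀)))

    Σℤ-outflow-target : (∀ {i j} → h₂ i ≡ h₂ j → i ≡ j) → ∀ i₀ → (∀ i → ¬ h₁ i ≡ h₂ i₀) →
                        Σℤ (λ i → outflow x (h₂ i₀) (h₁ i , h₂ i)) ≡ x (h₂ i₀) - x (h₁ i₀)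
    Σℤ-outflow-target injective i₀ h₁≢ = trans (Σℤ-outflow-split (h₂ i₀))
      (trans (cong₂ _-_ (Σℤ-indicator-outside h₁ (h₂ i₀) h₁≢ d) (Σℤ-indicator-injective h₂ injective i₀ d))
             (negate (x (h₁ i₀)) (x (h₂ i₀))))
      where
      negate : ∀ a b → + 0 - (a - b) ≡ b - a
      negate = solve-∀

    Σℤ-outflow-outside : ∀ u → (∀ i → ¬ h₁ i ≡ u) → (∀ i → ¬ h₂ i ≡ u) →
                         Σℤ (λ i → outflow x u (h₁ i , h₂ i)) ≡ + 0
    Σℤ-outflow-outside u h₁≢ h₂≢ = trans (Σℤ-outflow-split u)
      (cong₂ _-_ (Σℤ-indicator-outside h₁ u h₁≢ d) (Σℤ-indicator-outside h₂ u h₂≢ d))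

  outflow-flat : ∀ {K} (x : Fin K → ℤ) u {a b} → x a ≡ x b → outflow x u (a , b) ≡ + 0
  outflow-flat x u {a} {b} xa≡xb = trans (cong (incidence (a , b) u *_) (ℤ.i≡j⇒i-j≡0 xa≡xb)) (ℤ.*-zeroʳ (incidence (a , b) u))

  ParallelEdges : ℕ → (H : MultiGraph) → Fin (N H) → Fin (N H) → Set
  ParallelEdges k H a b = replicate k (a , b) ⊑ edges H

  step : ∀ {K} → ℤ → (Fin K → ℤ) → Fin K → ℤ
  step t x u = + ind (does (t ℤ.≤? x u))

  module _ {K : ℕ} (x : Fin K → ℤ) where

    dirichlet-swap : ∀ w a b → dirichlet w x (a , b) ≡ dirichlet w x (b , a)
    dirichlet-swap w a b = swap (w a) (w b) (x a) (x b)
      where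
      swap : ∀ wa wb xa xb → (wa - wb) * (xa - xb) ≡ (wb - wa) * (xb - xa)
      swap = solve-∀

    private
      ascending : ∀ a b → (+ 1 - + 0) * (a - b) ≡ a - b
      ascending = solve-∀
      descending : ∀ a b → (+ 0 - + 1) * (a - b) ≡ b - a
      descending = solve-∀

    dirichlet-step-nonneg : ∀ t e → + 0 ≤ dirichlet (step t x) x e
    dirichlet-step-nonneg t (a , b) with t ℤ.≤? x a | t ℤ.≤? x b
    ... | yes _   | yes _   = ℤ.≤-refl
    ... | no _    | no _    = ℤ.≤-refl
    ... | yes t≤a | no t≰b  = subst (+ 0 ≤_) (sym (ascending (x a) (x b)))
                                    (ℤ.i≤j⇒0≤j-i (ℤ.<⇒≤ (ℤ.<-≤-trans (ℤ.≰⇒> t≰b) t≤a)))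
    ... | no t≰a  | yes t≤b = subst (+ 0 ≤_) (sym (descending (x a) (x b)))
                                    (ℤ.i≤j⇒0≤j-i (ℤ.<⇒≤ (ℤ.<-≤-trans (ℤ.≰⇒> t≰a) t≤b)))

    dirichlet-step-crossing : ∀ a b → x a < x b → + 1 ≤ dirichlet (step (x b) x) x (a , b)
    dirichlet-step-crossing a b xa<xb with x b ℤ.≤? x a | x b ℤ.≤? x b
    ... | yes xb≤xa | _         = ⊥-elim (ℤ.<⇒≱ xa<xb xb≤xa)
    ... | no _      | no xb≰xb  = ⊥-elim (xb≰xb ℤ.≤-refl)
    ... | no _      | yes _     = subst (+ 1 ≤_) (sym (descending (x a) (x b))) (i<j⇒1≤j-i xa<xb)

  module _ (H : MultiGraph) (loopless : Loopless H) {x F : Divisor H}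
           (laplace≤F : ∀ u → laplace H x u ≤ F u) (F≥0 : ∀ u → + 0 ≤ F u) where

    Σℤ-step-laplace≤deg : ∀ t → Σℤ (λ u → step t x u * laplace H x u) ≤ Σℤ F
    Σℤ-step-laplace≤deg t = Σℤ-mono-≤ pointwise
      where
      pointwise : ∀ u → step t x u * laplace H x u ≤ F u
      pointwise u with does (t ℤ.≤? x u)
      ... | true  = subst (_≤ F u) (sym (ℤ.*-identityˡ _)) (laplace≤F u)
      ... | false = F≥0 u

    -- Cutting H along a level set of x crosses all k parallel copies of a non-flat edge.
    parallel-crossing≤deg : ∀ {k a b} → ParallelEdges k H a b → ∀ t →
                            + 1 ≤ dirichlet (step t x) x (a , b) → + k ≤ Σℤ F
    parallel-crossing≤deg {k} {a} {b} parallel t crossing = begin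
      + k                                              ≡⟨ sym (ℤ.*-identityʳ (+ k)) ⟩
      + k * + 1                                        ≤⟨ ℤ.*-monoˡ-≤-nonNeg (+ k) crossing ⟩
      + k * dirichlet (step t x) x (a , b)             ≡⟨ sym (sumℤ-replicate (dirichlet (step t x) x) k (a , b)) ⟩
      sumℤ (map (dirichlet (step t x) x) (replicate k (a , b)))
                                                       ≤⟨ sumℤ-mono parallel _ (dirichlet-step-nonneg x t) ⟩
      sumℤ (map (dirichlet (step t x) x) (edges H))    ≡⟨ sym (Σℤ-*-laplace H loopless (step t x) x) ⟩
      Σℤ (λ u → step t x u * laplace H x u)            ≤⟨ Σℤ-step-laplace≤deg t ⟩
      Σℤ F ∎
      where open ℤ.≤-Reasoning

    flat-on-parallel : ∀ {k a b} → Σℤ F < + k → ParallelEdges k H a b → x a ≡ x b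
    flat-on-parallel {k} {a} {b} deg<k parallel with ℤ.<-cmp (x a) (x b)
    ... | tri≈ _ xa≡xb _ = xa≡xb
    ... | tri< xa<xb _ _ = ⊥-elim (ℤ.<⇒≱ deg<k
            (parallel-crossing≤deg parallel (x b) (dirichlet-step-crossing x a b xa<xb)))
    ... | tri> _ _ xb<xa = ⊥-elim (ℤ.<⇒≱ deg<k
            (parallel-crossing≤deg parallel (x a)
              (subst (+ 1 ≤_) (dirichlet-swap x (step (x a) x) b a) (dirichlet-step-crossing x b a xb<xa))))

  module RankOne (H : MultiGraph) (loopless : Loopless H) (D : Divisor H) (rank : RankAtLeast H D 1) where

    private
      reduced : EquivEffective H (λ u → D u - + 0)
      reduced = rank (λ _ → + 0) (λ _ → ℤ.≤-refl) (subst (_≤ + 1) (sym (Σℤ-zero (N H))) (ℤ.+≤+ ℕ.z≤n))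

      minus-point : ∀ q → EquivEffective H (λ u → D u - indicator q u)
      minus-point q = rank (indicator q) (indicator≥0 q) (ℤ.≤-reflexive (deg-indicator q))

      F : Fin (N H) → Divisor H
      F q = proj₁ (minus-point q)

      F-effective : ∀ q → Effective {H} (F q)
      F-effective q = proj₁ (proj₂ (minus-point q))

      y : Fin (N H) → Divisor H
      y q = proj₁ (proj₂ (proj₂ (minus-point q)))

      y-equation : ∀ q u → D u - indicator q u - F q u ≡ laplace H (y q) u
      y-equation q = proj₂ (proj₂ (proj₂ (minus-point q)))

      y₀ : Divisor H
      y₀ = proj₁ (proj₂ (proj₂ reduced))

    F₀ : Divisor H
    F₀ = proj₁ reduced

    F₀-effective : Effective {H} F₀
    F₀-effective = proj₁ (proj₂ reduced)

    private
      y₀-equation : ∀ u → D u - + 0 - F₀ u ≡ laplace H y₀ u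
      y₀-equation = proj₂ (proj₂ (proj₂ reduced))

    deg-D : deg {H} D ≡ deg {H} F₀
    deg-D = begin
      Σℤ D                                        ≡⟨ Σℤ-cong (λ u → split (D u) (F₀ u)) ⟩
      Σℤ (λ u → (D u - + 0 - F₀ u) + F₀ u)        ≡⟨ Σℤ-+ {N H} _ F₀ ⟩
      Σℤ (λ u → D u - + 0 - F₀ u) + Σℤ F₀         ≡⟨ cong (_+ Σℤ F₀) (Σℤ-cong y₀-equation) ⟩
      Σℤ (laplace H y₀) + Σℤ F₀                   ≡⟨ cong (_+ Σℤ F₀) (deg-laplace H loopless y₀) ⟩
      + 0 + Σℤ F₀                                 ≡⟨ ℤ.+-identityˡ _ ⟩
      Σℤ F₀ ∎
      where
      open ≡-Reasoning
      split : ∀ d f → d ≡ (d - + 0 - f) + f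
      split = solve-∀

    firing : Fin (N H) → Divisor H
    firing q u = y q u - y₀ u

    indicator+laplace≤F₀ : ∀ q u → indicator q u + laplace H (firing q) u ≤ F₀ u
    indicator+laplace≤F₀ q u = ≤-by-slack (F q u) (F-effective q u) (begin
      indicator q u + laplace H (firing q) u + F q u
        ≡⟨ cong (λ l → indicator q u + l + F q u) (laplace-- H (y q) y₀ u) ⟩
      indicator q u + (laplace H (y q) u - laplace H y₀ u) + F q u
        ≡⟨ cong₂ (λ a b → indicator q u + (a - b) + F q u) (sym (y-equation q u)) (sym (y₀-equation u)) ⟩
      indicator q u + ((D u - indicator q u - F q u) - (D u - + 0 - F₀ u)) + F q u
        ≡⟨ cancel (indicator q u) (D u) (F q u) (F₀ u) ⟩
      F₀ u ∎)
      where
      open ≡-Reasoning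
      cancel : ∀ c d f f₀ → c + ((d - c - f) - (d - + 0 - f₀)) + f ≡ f₀
      cancel = solve-∀

  equivEffective-if-≤ : (H : MultiGraph) (D : Divisor H) {F E : Divisor H} → LinEquiv H D F → (∀ u → E u ≤ F u) →
                        EquivEffective H (λ u → D u - E u)
  equivEffective-if-≤ H D {F} {E} (x , D-F≡Qx) E≤F =
    (λ u → F u - E u) , (λ u → ℤ.i≤j⇒0≤j-i (E≤F u)) , x , λ u → trans (cancel (D u) (E u) (F u)) (D-F≡Qx u)
    where
    cancel : ∀ d e f → d - e - (f - e) ≡ d - f
    cancel = solve-∀

  rank≥1 : (H : MultiGraph) (D : Divisor H) → Fin (N H) →
           (∀ q → ∃ λ (F : Divisor H) → Effective {H} F × LinEquiv H D F × + 1 ≤ F q) → RankAtLeast H D 1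
  rank≥1 H D q₀ witness E E≥0 degE≤1 = cover (Fin.any? (λ q → + 1 ℤ.≤? E q))
    where
    cover : Dec (∃ λ q → + 1 ≤ E q) → EquivEffective H (λ u → D u - E u)
    cover (yes (q , 1≤Eq)) with witness q
    ... | F , F≥0 , D~F , 1≤Fq = equivEffective-if-≤ H D D~F E≤F
      where
      rearrange : ∀ a b → (+ 1 - (a + b)) + (b - + 1) ≡ - a
      rearrange = solve-∀
      E≤F : ∀ u → E u ≤ F u
      E≤F u with u ≟ q
      ... | yes refl = ℤ.≤-trans (ℤ.≤-trans (term≤Σℤ E≥0 q) degE≤1) 1≤Fq
      ... | no u≢q   = ℤ.≤-trans Eu≤0 (F≥0 u)
        where
        Eu≤0 : E u ≤ + 0
        Eu≤0 = ≤-by-slack (- E u)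
          (subst (+ 0 ≤_) (rearrange (E u) (E q))
                 (ℤ.+-mono-≤ (ℤ.i≤j⇒0≤j-i (ℤ.≤-trans (two-terms≤Σℤ E≥0 u q u≢q) degE≤1))
                             (ℤ.i≤j⇒0≤j-i 1≤Eq)))
          (ℤ.+-inverseʳ (E u))
    cover (no ∄q) with witness q₀
    ... | F , F≥0 , D~F , _ = equivEffective-if-≤ H D D~F
      (λ u → ℤ.≤-trans (ℤ.i<j⇒i≤pred[j] (ℤ.≰⇒> (λ 1≤Eu → ∄q (u , 1≤Eu)))) (F≥0 u))

  module HatGraph (n m : ℕ) (ends : Fin m → Fin n × Fin n) where

    open Hat n m

    Ĝ : MultiGraph
    Ĝ = hat n m ends

    M : ℕ
    M = 3 ℕ.* n ℕ.+ 2 ℕ.* m ℕ.+ 2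

    end₁ end₂ : Fin m → Fin n
    end₁ e = proj₁ (ends e)
    end₂ e = proj₂ (ends e)

    data Node : Set where
      T         : Node
      V V′ Tᵥ   : Fin n → Node
      E₁ E₂     : Fin m → Node

    ⌜_⌝ : Node → Fin (hatN n m)
    ⌜ T ⌝     = nT
    ⌜ V v ⌝   = nV v
    ⌜ V′ v ⌝  = nV' v
    ⌜ Tᵥ v ⌝  = nTv v
    ⌜ E₁ e ⌝  = nE₁ e
    ⌜ E₂ e ⌝  = nE₂ e

    private
      decode₄ : Fin (m ℕ.+ m) → Node
      decode₄ = [ E₁ , E₂ ]′ ∘ splitAt m
      decode₃ : Fin (n ℕ.+ (m ℕ.+ m)) → Node
      decode₃ = [ Tᵥ , decode₄ ]′ ∘ splitAt n
      decode₂ : Fin (n ℕ.+ (n ℕ.+ (m ℕ.+ m))) → Node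
      decode₂ = [ V′ , decode₃ ]′ ∘ splitAt n
      decode₁ : Fin (n ℕ.+ (n ℕ.+ (n ℕ.+ (m ℕ.+ m)))) → Node
      decode₁ = [ V , decode₂ ]′ ∘ splitAt n

    decode : Fin (hatN n m) → Node
    decode zero    = T
    decode (suc i) = decode₁ i

    decode-⌜⌝ : ∀ s → decode ⌜ s ⌝ ≡ s
    decode-⌜⌝ T = refl
    decode-⌜⌝ (V v)
      rewrite splitAt-↑ˡ n v (n ℕ.+ (n ℕ.+ (m ℕ.+ m))) = refl
    decode-⌜⌝ (V′ v)
      rewrite splitAt-↑ʳ n (n ℕ.+ (n ℕ.+ (m ℕ.+ m))) (v ↑ˡ (n ℕ.+ (m ℕ.+ m)))
            | splitAt-↑ˡ n v (n ℕ.+ (m ℕ.+ m)) = refl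
    decode-⌜⌝ (Tᵥ v)
      rewrite splitAt-↑ʳ n (n ℕ.+ (n ℕ.+ (m ℕ.+ m))) (n ↑ʳ (v ↑ˡ (m ℕ.+ m)))
            | splitAt-↑ʳ n (n ℕ.+ (m ℕ.+ m)) (v ↑ˡ (m ℕ.+ m))
            | splitAt-↑ˡ n v (m ℕ.+ m) = refl
    decode-⌜⌝ (E₁ e)
      rewrite splitAt-↑ʳ n (n ℕ.+ (n ℕ.+ (m ℕ.+ m))) (n ↑ʳ n ↑ʳ (e ↑ˡ m))
            | splitAt-↑ʳ n (n ℕ.+ (m ℕ.+ m)) (n ↑ʳ (e ↑ˡ m))
            | splitAt-↑ʳ n (m ℕ.+ m) (e ↑ˡ m)
            | splitAt-↑ˡ m e m = refl
    decode-⌜⌝ (E₂ e)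
      rewrite splitAt-↑ʳ n (n ℕ.+ (n ℕ.+ (m ℕ.+ m))) (n ↑ʳ n ↑ʳ (m ↑ʳ e))
            | splitAt-↑ʳ n (n ℕ.+ (m ℕ.+ m)) (n ↑ʳ (m ↑ʳ e))
            | splitAt-↑ʳ n (m ℕ.+ m) (m ↑ʳ e)
            | splitAt-↑ʳ m m e = refl

    ⌜⌝-decode : ∀ u → ⌜ decode u ⌝ ≡ u
    ⌜⌝-decode zero    = refl
    ⌜⌝-decode (suc i) = ⌜⌝-decode₁ i
      where
      ⌜⌝-decode₄ : ∀ j → ⌜ decode₄ j ⌝ ≡ suc (n ↑ʳ n ↑ʳ n ↑ʳ j)
      ⌜⌝-decode₄ j with splitAt m j in eq
      ... | inj₁ _ = cong (λ k → suc (n ↑ʳ n ↑ʳ n ↑ʳ k)) (splitAt⁻¹-↑ˡ eq)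
      ... | inj₂ _ = cong (λ k → suc (n ↑ʳ n ↑ʳ n ↑ʳ k)) (splitAt⁻¹-↑ʳ eq)
      ⌜⌝-decode₃ : ∀ j → ⌜ decode₃ j ⌝ ≡ suc (n ↑ʳ n ↑ʳ j)
      ⌜⌝-decode₃ j with splitAt n j in eq
      ... | inj₁ _ = cong (λ k → suc (n ↑ʳ n ↑ʳ k)) (splitAt⁻¹-↑ˡ eq)
      ... | inj₂ k = trans (⌜⌝-decode₄ k) (cong (λ k → suc (n ↑ʳ n ↑ʳ k)) (splitAt⁻¹-↑ʳ eq))
      ⌜⌝-decode₂ : ∀ j → ⌜ decode₂ j ⌝ ≡ suc (n ↑ʳ j)
      ⌜⌝-decode₂ j with splitAt n j in eq
      ... | inj₁ _ = cong (λ k → suc (n ↑ʳ k)) (splitAt⁻¹-↑ˡ eq)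
      ... | inj₂ k = trans (⌜⌝-decode₃ k) (cong (λ k → suc (n ↑ʳ k)) (splitAt⁻¹-↑ʳ eq))
      ⌜⌝-decode₁ : ∀ j → ⌜ decode₁ j ⌝ ≡ suc j
      ⌜⌝-decode₁ j with splitAt n j in eq
      ... | inj₁ _ = cong suc (splitAt⁻¹-↑ˡ eq)
      ... | inj₂ k = trans (⌜⌝-decode₂ k) (cong suc (splitAt⁻¹-↑ʳ eq))

    ⌜⌝-injective : ∀ {s t} → ⌜ s ⌝ ≡ ⌜ t ⌝ → s ≡ t
    ⌜⌝-injective {s} {t} eq = trans (sym (decode-⌜⌝ s)) (trans (cong decode eq) (decode-⌜⌝ t))

    Σℤ-Ĝ : (f : Fin (hatN n m) → ℤ) →
           Σℤ f ≡ f ⌜ T ⌝ + (Σℤ (λ v → f ⌜ V v ⌝) + (Σℤ (λ v → f ⌜ V′ v ⌝) + (Σℤ (λ v → f ⌜ Tᵥ v ⌝)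
                  + (Σℤ (λ e → f ⌜ E₁ e ⌝) + Σℤ (λ e → f ⌜ E₂ e ⌝)))))
    Σℤ-Ĝ f = cong (_+_ (f nT))
      (trans (Σℤ-↑ n _ (λ i → f (suc i))) (cong (_+_ (Σℤ (λ v → f (nV v))))
      (trans (Σℤ-↑ n _ (λ i → f (suc (n ↑ʳ i)))) (cong (_+_ (Σℤ (λ v → f (nV' v))))
      (trans (Σℤ-↑ n _ (λ i → f (suc (n ↑ʳ n ↑ʳ i)))) (cong (_+_ (Σℤ (λ v → f (nTv v))))
             (Σℤ-↑ m m (λ i → f (suc (n ↑ʳ n ↑ʳ n ↑ʳ i))))))))))

    Σℤ-Ĝ-grouped : (f : Fin (hatN n m) → ℤ) →
                   Σℤ f ≡ f ⌜ T ⌝ + Σℤ (λ v → f ⌜ V v ⌝) + Σℤ (λ v → f ⌜ V′ v ⌝ + f ⌜ Tᵥ v ⌝)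
                          + Σℤ (λ e → f ⌜ E₁ e ⌝ + f ⌜ E₂ e ⌝)
    Σℤ-Ĝ-grouped f = trans (Σℤ-Ĝ f)
      (trans (reassociate (f nT) (Σℤ (λ v → f (nV v))) (Σℤ (λ v → f (nV' v))) (Σℤ (λ v → f (nTv v)))
                          (Σℤ (λ e → f (nE₁ e))) (Σℤ (λ e → f (nE₂ e))))
             (sym (cong₂ (λ a b → f nT + Σℤ (λ v → f (nV v)) + a + b)
                         (Σℤ-+ (λ v → f (nV' v)) (λ v → f (nTv v))) (Σℤ-+ (λ e → f (nE₁ e)) (λ e → f (nE₂ e))))))
      where
      reassociate : ∀ a b c d e₁ e₂ → a + (b + (c + (d + (e₁ + e₂)))) ≡ a + b + (c + d) + (e₁ + e₂)
      reassociate = solve-∀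

    edgeGadget : Fin m → List (Fin (hatN n m) × Fin (hatN n m))
    edgeGadget e = (⌜ E₁ e ⌝ , ⌜ E₂ e ⌝) ∷ replicate M (⌜ V (end₁ e) ⌝ , ⌜ E₁ e ⌝)
                                         ++ replicate M (⌜ E₂ e ⌝ , ⌜ V (end₂ e) ⌝)

    vertexGadget : Fin n → List (Fin (hatN n m) × Fin (hatN n m))
    vertexGadget v = replicate 3 (⌜ V′ v ⌝ , ⌜ Tᵥ v ⌝) ++ replicate M (⌜ V v ⌝ , ⌜ V′ v ⌝)
                                                      ++ replicate M (⌜ Tᵥ v ⌝ , ⌜ T ⌝)

    private
      ⌜⌝-≢ : ∀ {k} (c : Fin k → Node) s → (∀ i → ¬ c i ≡ s) → ∀ i → ¬ ⌜ c i ⌝ ≡ ⌜ s ⌝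
      ⌜⌝-≢ c s c≢s i eq = c≢s i (⌜⌝-injective eq)

      ⌜⌝-injective∘ : ∀ {k} (c : Fin k → Node) → (∀ {i j} → c i ≡ c j → i ≡ j) →
                      ∀ {i j} → ⌜ c i ⌝ ≡ ⌜ c j ⌝ → i ≡ j
      ⌜⌝-injective∘ c injective eq = injective (⌜⌝-injective eq)

      loopless-edgeGadget : ∀ e → All (λ a → ¬ proj₁ a ≡ proj₂ a) (edgeGadget e)
      loopless-edgeGadget e = ⌜⌝-≢ E₁ (E₂ e) (λ _ ()) e
        ∷ ++⁺ (replicate⁺ M (⌜⌝-≢ V (E₁ e) (λ _ ()) (end₁ e))) (replicate⁺ M (⌜⌝-≢ E₂ (V (end₂ e)) (λ _ ()) e))

      loopless-vertexGadget : ∀ v → All (λ a → ¬ proj₁ a ≡ proj₂ a) (vertexGadget v)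
      loopless-vertexGadget v = ++⁺ (replicate⁺ 3 (⌜⌝-≢ V′ (Tᵥ v) (λ _ ()) v))
        (++⁺ (replicate⁺ M (⌜⌝-≢ V (V′ v) (λ _ ()) v)) (replicate⁺ M (⌜⌝-≢ Tᵥ T (λ _ ()) v)))

    loopless : Loopless Ĝ
    loopless = ++⁺ (concat⁺ (map⁺ (tabulate⁺ loopless-edgeGadget))) (concat⁺ (map⁺ (tabulate⁺ loopless-vertexGadget)))

    edgeGadget⊑ : ∀ e → edgeGadget e ⊑ edges Ĝ
    edgeGadget⊑ e = ⊑-trans (⊑-concatMap edgeGadget e) (xs⊑xs++ys _ _)

    vertexGadget⊑ : ∀ v → vertexGadget v ⊑ edges Ĝ
    vertexGadget⊑ v = ⊑-trans (⊑-concatMap vertexGadget v) (ys⊑xs++ys _ _)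

    parallel-V-E₁ : ∀ e → ParallelEdges M Ĝ ⌜ V (end₁ e) ⌝ ⌜ E₁ e ⌝
    parallel-V-E₁ e = ⊑-trans (xs⊑xs++ys _ (replicate M (⌜ E₂ e ⌝ , ⌜ V (end₂ e) ⌝)))
                     (⊑-trans (ys⊑xs++ys ((⌜ E₁ e ⌝ , ⌜ E₂ e ⌝) ∷ []) _) (edgeGadget⊑ e))

    parallel-E₂-V : ∀ e → ParallelEdges M Ĝ ⌜ E₂ e ⌝ ⌜ V (end₂ e) ⌝
    parallel-E₂-V e = ⊑-trans (ys⊑xs++ys (replicate M (⌜ V (end₁ e) ⌝ , ⌜ E₁ e ⌝)) _)
                     (⊑-trans (ys⊑xs++ys ((⌜ E₁ e ⌝ , ⌜ E₂ e ⌝) ∷ []) _) (edgeGadget⊑ e))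

    parallel-V-V′ : ∀ v → ParallelEdges M Ĝ ⌜ V v ⌝ ⌜ V′ v ⌝
    parallel-V-V′ v = ⊑-trans (xs⊑xs++ys _ (replicate M (⌜ Tᵥ v ⌝ , ⌜ T ⌝)))
                     (⊑-trans (ys⊑xs++ys (replicate 3 (⌜ V′ v ⌝ , ⌜ Tᵥ v ⌝)) _) (vertexGadget⊑ v))

    parallel-Tᵥ-T : ∀ v → ParallelEdges M Ĝ ⌜ Tᵥ v ⌝ ⌜ T ⌝
    parallel-Tᵥ-T v = ⊑-trans (ys⊑xs++ys (replicate M (⌜ V v ⌝ , ⌜ V′ v ⌝)) _)
                     (⊑-trans (ys⊑xs++ys (replicate 3 (⌜ V′ v ⌝ , ⌜ Tᵥ v ⌝)) _) (vertexGadget⊑ v))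

    record Flat (x : Fin (hatN n m) → ℤ) : Set where
      field
        flat-V′ : ∀ v → x ⌜ V′ v ⌝ ≡ x ⌜ V v ⌝
        flat-Tᵥ : ∀ v → x ⌜ Tᵥ v ⌝ ≡ x ⌜ T ⌝
        flat-E₁ : ∀ e → x ⌜ E₁ e ⌝ ≡ x ⌜ V (end₁ e) ⌝
        flat-E₂ : ∀ e → x ⌜ E₂ e ⌝ ≡ x ⌜ V (end₂ e) ⌝

    -- The Laplacian of a flat vector with value t at T and values y at the nodes V.
    flatLaplace : ℤ → (Fin n → ℤ) → Node → ℤ
    flatLaplace t y T      = + 0
    flatLaplace t y (V v)  = + 0
    flatLaplace t y (V′ v) = + 3 * (y v - t)
    flatLaplace t y (Tᵥ v) = + 3 * (t - y v)
    flatLaplace t y (E₁ e) = y (end₁ e) - y (end₂ e)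
    flatLaplace t y (E₂ e) = y (end₂ e) - y (end₁ e)

    flatLaplace-cong : ∀ t {y y′ : Fin n → ℤ} → (∀ v → y v ≡ y′ v) → ∀ s → flatLaplace t y s ≡ flatLaplace t y′ s
    flatLaplace-cong t y≗y′ T      = refl
    flatLaplace-cong t y≗y′ (V v)  = refl
    flatLaplace-cong t y≗y′ (V′ v) = cong (λ a → + 3 * (a - t)) (y≗y′ v)
    flatLaplace-cong t y≗y′ (Tᵥ v) = cong (λ a → + 3 * (t - a)) (y≗y′ v)
    flatLaplace-cong t y≗y′ (E₁ e) = cong₂ _-_ (y≗y′ (end₁ e)) (y≗y′ (end₂ e))
    flatLaplace-cong t y≗y′ (E₂ e) = cong₂ _-_ (y≗y′ (end₂ e)) (y≗y′ (end₁ e))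

    module _ {x : Fin (hatN n m) → ℤ} (flat : Flat x) where
      open Flat flat

      private
        bundle : ∀ {k} → (Fin k → Node) → (Fin k → Node) → Fin (hatN n m) → ℤ
        bundle c₁ c₂ u = Σℤ (λ i → outflow x u (⌜ c₁ i ⌝ , ⌜ c₂ i ⌝))

        heavy-outflow : ∀ u k {a b} → x a ≡ x b → sumℤ (map (outflow x u) (replicate k (a , b))) ≡ + 0
        heavy-outflow u k {a} {b} xa≡xb = trans (sumℤ-replicate (outflow x u) k (a , b))
                                                (trans (cong (+ k *_) (outflow-flat x u xa≡xb)) (ℤ.*-zeroʳ (+ k)))

        edgeGadget-outflow : ∀ u e → sumℤ (map (outflow x u) (edgeGadget e)) ≡ outflow x u (⌜ E₁ e ⌝ , ⌜ E₂ e ⌝)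
        edgeGadget-outflow u e = trans
          (cong (_+_ (outflow x u (⌜ E₁ e ⌝ , ⌜ E₂ e ⌝)))
                (trans (sumℤ-++ (outflow x u) (replicate M _) (replicate M _))
                       (cong₂ _+_ (heavy-outflow u M (sym (flat-E₁ e))) (heavy-outflow u M (flat-E₂ e)))))
          (ℤ.+-identityʳ _)

        vertexGadget-outflow : ∀ u v → sumℤ (map (outflow x u) (vertexGadget v)) ≡ + 3 * outflow x u (⌜ V′ v ⌝ , ⌜ Tᵥ v ⌝)
        vertexGadget-outflow u v = trans (sumℤ-++ (outflow x u) (replicate 3 (⌜ V′ v ⌝ , ⌜ Tᵥ v ⌝))
                                                  (replicate M (⌜ V v ⌝ , ⌜ V′ v ⌝) ++ replicate M (⌜ Tᵥ v ⌝ , ⌜ T ⌝)))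
          (trans (cong₂ _+_ (sumℤ-replicate (outflow x u) 3 (⌜ V′ v ⌝ , ⌜ Tᵥ v ⌝))
                            (trans (sumℤ-++ (outflow x u) (replicate M (⌜ V v ⌝ , ⌜ V′ v ⌝))
                                                          (replicate M (⌜ Tᵥ v ⌝ , ⌜ T ⌝)))
                                   (cong₂ _+_ (heavy-outflow u M (sym (flat-V′ v))) (heavy-outflow u M (flat-Tᵥ v)))))
                 (ℤ.+-identityʳ _))

        laplace-bundles : ∀ u → laplace Ĝ x u ≡ bundle E₁ E₂ u + + 3 * bundle V′ Tᵥ u
        laplace-bundles u = begin
          laplace Ĝ x u
            ≡⟨ laplace-outflow Ĝ loopless x u ⟩
          sumℤ (map (outflow x u) (concatMap edgeGadget (allFin m) ++ concatMap vertexGadget (allFin n)))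
            ≡⟨ sumℤ-++ (outflow x u) (concatMap edgeGadget (allFin m)) _ ⟩
          sumℤ (map (outflow x u) (concatMap edgeGadget (allFin m))) + sumℤ (map (outflow x u) (concatMap vertexGadget (allFin n)))
            ≡⟨ cong₂ _+_ (sumℤ-concatMap (outflow x u) edgeGadget (λ e → e))
                         (sumℤ-concatMap (outflow x u) vertexGadget (λ v → v)) ⟩
          Σℤ (λ e → sumℤ (map (outflow x u) (edgeGadget e))) + Σℤ (λ v → sumℤ (map (outflow x u) (vertexGadget v)))
            ≡⟨ cong₂ _+_ (Σℤ-cong (edgeGadget-outflow u)) (trans (Σℤ-cong (vertexGadget-outflow u)) (Σℤ-*ˡ {n} (+ 3) _)) ⟩
          bundle E₁ E₂ u + + 3 * bundle V′ Tᵥ u ∎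
          where open ≡-Reasoning

        source : ∀ {k} (c₁ c₂ : Fin k → Node) → (∀ {i j} → c₁ i ≡ c₁ j → i ≡ j) →
                 ∀ i₀ → (∀ i → ¬ c₂ i ≡ c₁ i₀) →
                 bundle c₁ c₂ ⌜ c₁ i₀ ⌝ ≡ x ⌜ c₁ i₀ ⌝ - x ⌜ c₂ i₀ ⌝
        source c₁ c₂ injective i₀ c₂≢ =
          Σℤ-outflow-source (⌜_⌝ ∘ c₁) (⌜_⌝ ∘ c₂) x (⌜⌝-injective∘ c₁ injective) i₀
                            (⌜⌝-≢ c₂ (c₁ i₀) c₂≢)

        target : ∀ {k} (c₁ c₂ : Fin k → Node) → (∀ {i j} → c₂ i ≡ c₂ j → i ≡ j) →
                 ∀ i₀ → (∀ i → ¬ c₁ i ≡ c₂ i₀) →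
                 bundle c₁ c₂ ⌜ c₂ i₀ ⌝ ≡ x ⌜ c₂ i₀ ⌝ - x ⌜ c₁ i₀ ⌝
        target c₁ c₂ injective i₀ c₁≢ =
          Σℤ-outflow-target (⌜_⌝ ∘ c₁) (⌜_⌝ ∘ c₂) x (⌜⌝-injective∘ c₂ injective) i₀
                            (⌜⌝-≢ c₁ (c₂ i₀) c₁≢)

        outside : ∀ {k} (c₁ c₂ : Fin k → Node) s → (∀ i → ¬ c₁ i ≡ s) → (∀ i → ¬ c₂ i ≡ s) →
                  bundle c₁ c₂ ⌜ s ⌝ ≡ + 0
        outside c₁ c₂ s c₁≢ c₂≢ =
          Σℤ-outflow-outside (⌜_⌝ ∘ c₁) (⌜_⌝ ∘ c₂) x ⌜ s ⌝ (⌜⌝-≢ c₁ s c₁≢) (⌜⌝-≢ c₂ s c₂≢)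

      laplace-flat : ∀ s → laplace Ĝ x ⌜ s ⌝ ≡ flatLaplace (x ⌜ T ⌝) (λ v → x ⌜ V v ⌝) s
      laplace-flat T = trans (laplace-bundles nT)
        (cong₂ (λ a b → a + + 3 * b) (outside E₁ E₂ T (λ _ ()) (λ _ ())) (outside V′ Tᵥ T (λ _ ()) (λ _ ())))
      laplace-flat (V v) = trans (laplace-bundles (nV v))
        (cong₂ (λ a b → a + + 3 * b) (outside E₁ E₂ (V v) (λ _ ()) (λ _ ())) (outside V′ Tᵥ (V v) (λ _ ()) (λ _ ())))
      laplace-flat (V′ v) = trans (laplace-bundles (nV' v))
        (trans (cong₂ (λ a b → a + + 3 * b) (outside E₁ E₂ (V′ v) (λ _ ()) (λ _ ()))
                                           (source V′ Tᵥ (λ { refl → refl }) v (λ _ ())))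
               (trans (ℤ.+-identityˡ _) (cong₂ (λ a b → + 3 * (a - b)) (flat-V′ v) (flat-Tᵥ v))))
      laplace-flat (Tᵥ v) = trans (laplace-bundles (nTv v))
        (trans (cong₂ (λ a b → a + + 3 * b) (outside E₁ E₂ (Tᵥ v) (λ _ ()) (λ _ ()))
                                           (target V′ Tᵥ (λ { refl → refl }) v (λ _ ())))
               (trans (ℤ.+-identityˡ _) (cong₂ (λ a b → + 3 * (a - b)) (flat-Tᵥ v) (flat-V′ v))))
      laplace-flat (E₁ e) = trans (laplace-bundles (nE₁ e))
        (trans (cong₂ (λ a b → a + + 3 * b) (source E₁ E₂ (λ { refl → refl }) e (λ _ ()))
                                           (outside V′ Tᵥ (E₁ e) (λ _ ()) (λ _ ())))
               (trans (ℤ.+-identityʳ _) (cong₂ _-_ (flat-E₁ e) (flat-E₂ e))))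
      laplace-flat (E₂ e) = trans (laplace-bundles (nE₂ e))
        (trans (cong₂ (λ a b → a + + 3 * b) (target E₁ E₂ (λ { refl → refl }) e (λ _ ()))
                                           (outside V′ Tᵥ (E₂ e) (λ _ ()) (λ _ ())))
               (trans (ℤ.+-identityʳ _) (cong₂ _-_ (flat-E₂ e) (flat-E₁ e))))

    flat-if-small : ∀ {x F : Fin (hatN n m) → ℤ} → (∀ u → laplace Ĝ x u ≤ F u) → (∀ u → + 0 ≤ F u) →
                    Σℤ F < + M → Flat x
    flat-if-small {x} laplace≤F F≥0 deg<M = record
      { flat-V′ = λ v → sym (flat (parallel-V-V′ v))
      ; flat-Tᵥ = λ v → flat (parallel-Tᵥ-T v)
      ; flat-E₁ = λ e → sym (flat (parallel-V-E₁ e))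
      ; flat-E₂ = λ e → flat (parallel-E₂-V e)
      }
      where
      flat : ∀ {a b} → ParallelEdges M Ĝ a b → x a ≡ x b
      flat = flat-on-parallel Ĝ loopless laplace≤F F≥0 deg<M

    extendNode : ℤ → (Fin n → ℤ) → Node → ℤ
    extendNode t y T      = t
    extendNode t y (V v)  = y v
    extendNode t y (V′ v) = y v
    extendNode t y (Tᵥ v) = t
    extendNode t y (E₁ e) = y (end₁ e)
    extendNode t y (E₂ e) = y (end₂ e)

    extend : ℤ → (Fin n → ℤ) → Fin (hatN n m) → ℤ
    extend t y u = extendNode t y (decode u)

    extend-⌜⌝ : ∀ t y s → extend t y ⌜ s ⌝ ≡ extendNode t y s
    extend-⌜⌝ t y s = cong (extendNode t y) (decode-⌜⌝ s)

    extend-flat : ∀ t y → Flat (extend t y)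
    extend-flat t y = record
      { flat-V′ = λ v → trans (extend-⌜⌝ t y (V′ v)) (sym (extend-⌜⌝ t y (V v)))
      ; flat-Tᵥ = λ v → extend-⌜⌝ t y (Tᵥ v)
      ; flat-E₁ = λ e → trans (extend-⌜⌝ t y (E₁ e)) (sym (extend-⌜⌝ t y (V (end₁ e))))
      ; flat-E₂ = λ e → trans (extend-⌜⌝ t y (E₂ e)) (sym (extend-⌜⌝ t y (V (end₂ e))))
      }

    laplace-extend : ∀ t y s → laplace Ĝ (extend t y) ⌜ s ⌝ ≡ flatLaplace t y s
    laplace-extend t y s = trans (laplace-flat (extend-flat t y) s) (flatLaplace-cong t (λ v → extend-⌜⌝ t y (V v)) s)

    every-node : {P : Fin (hatN n m) → Set} → (∀ s → P ⌜ s ⌝) → ∀ u → P u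
    every-node {P} P⌜⌝ u = subst P (⌜⌝-decode u) (P⌜⌝ (decode u))


    count≤α+inner-edges : ∀ {α} → (∀ S → Independent ends S → ∣ S ∣ ℕ.≤ α) → (f : Fin n → Bool) →
                    Σℤ (λ v → + ind (f v)) ≤ + α + Σℤ (λ e → + ind (f (end₁ e) ∧ f (end₂ e)))
    count≤α+inner-edges {α} α-max f = begin
      Σℤ (λ v → + ind (f v))
        ≤⟨ Σℤ-mono-≤ pointwise ⟩
      Σℤ (λ v → + ind (keep v) + Σℤ (λ e → inner e v))
        ≡⟨ Σℤ-+ {n} _ _ ⟩
      Σℤ (λ v → + ind (keep v)) + Σℤ (λ v → Σℤ (λ e → inner e v))
        ≡⟨ cong₂ _+_ (trans (Σℤ-cong (λ v → cong (λ b → + ind b) (sym (lookup∘tabulate keep v)))) (Σℤ-∣∣ S))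
                     (trans (sym (Σℤ-swap inner))
                            (Σℤ-cong (λ e → Σℤ-indicator (end₁ e) (λ v → + ind (f v ∧ f (end₂ e)))))) ⟩
      + ∣ S ∣ + Σℤ (λ e → + ind (f (end₁ e) ∧ f (end₂ e)))
        ≤⟨ ℤ.+-monoˡ-≤ (Σℤ (λ e → + ind (f (end₁ e) ∧ f (end₂ e)))) (ℤ.+≤+ (α-max S S-independent)) ⟩
      + α + Σℤ (λ e → + ind (f (end₁ e) ∧ f (end₂ e))) ∎
      where
      open ℤ.≤-Reasoning

      conflict? : ∀ v → Dec (∃ λ e → end₁ e ≡ v × f (end₂ e) ≡ true)
      conflict? v = Fin.any? (λ e → (end₁ e ≟ v) ×-dec (f (end₂ e) Bool.≟ true))

      keep : Fin n → Bool
      keep v = f v ∧ not (does (conflict? v))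

      S : Subset n
      S = Vec.tabulate keep

      S-independent : Independent ends S
      S-independent e (end₁∈S , end₂∈S) = kept-conflict (kept end₁∈S) (kept end₂∈S)
        where
        kept : ∀ {v} → v ∈ S → keep v ≡ true
        kept {v} v∈S = trans (sym (lookup∘tabulate keep v)) ([]=⇒lookup v∈S)
        kept-conflict : keep (end₁ e) ≡ true → keep (end₂ e) ≡ true → ⊥
        kept-conflict k₁ k₂ with f (end₂ e) in f₂ | conflict? (end₁ e)
        kept-conflict k₁ () | false | _
        ... | true | no ∄e = ∄e (e , refl , f₂)
        ... | true | yes _ with () ← trans (sym (Bool.∧-zeroʳ (f (end₁ e)))) k₁

      inner : Fin m → Fin n → ℤ
      inner e v = if does (end₁ e ≟ v) then + ind (f v ∧ f (end₂ e)) else + 0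

      inner≥0 : ∀ c k → + 0 ≤ (if c then + k else + 0)
      inner≥0 true  k = ℤ.+≤+ ℕ.z≤n
      inner≥0 false k = ℤ.≤-refl

      pointwise : ∀ v → + ind (f v) ≤ + ind (keep v) + Σℤ (λ e → inner e v)
      pointwise v with f v | conflict? v
      ... | false | _  = ℤ.+-mono-≤ (ℤ.+≤+ ℕ.z≤n) (Σℤ-nonneg {m} (λ _ → inner≥0 _ _))
      ... | true  | no _ = ≤-by-slack _ (Σℤ-nonneg {m} (λ _ → inner≥0 _ _)) refl
      ... | true  | yes (e , refl , f₂) = ℤ.≤-trans one
            (ℤ.≤-trans (term≤Σℤ {m} (λ _ → inner≥0 _ _) e) (ℤ.≤-reflexive (sym (ℤ.+-identityˡ _))))
        where
        one : + 1 ≤ (if does (end₁ e ≟ end₁ e) then + ind (true ∧ f (end₂ e)) else + 0)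
        one with end₁ e ≟ end₁ e
        ... | yes _ rewrite f₂ = ℤ.≤-refl
        ... | no ≢  = ⊥-elim (≢ refl)

    ℕ→ℤ-gonality : ∀ α → + (4 ℕ.* n ℕ.+ m ℕ.+ 1) - + α ≡ + 4 * + n + + m + + 1 - + α
    ℕ→ℤ-gonality α = cong (_- + α) (trans (ℤ.pos-+ (4 ℕ.* n ℕ.+ m) 1)
                                     (cong (_+ + 1) (trans (ℤ.pos-+ (4 ℕ.* n) m) (cong (_+ + m) (ℤ.pos-* 4 n)))))

    ℕ→ℤ-M : + M ≡ + 3 * + n + + 2 * + m + + 2
    ℕ→ℤ-M = trans (ℤ.pos-+ (3 ℕ.* n ℕ.+ 2 ℕ.* m) 2)
                  (cong (_+ + 2) (trans (ℤ.pos-+ (3 ℕ.* n) (2 ℕ.* m)) (cong₂ _+_ (ℤ.pos-* 3 n) (ℤ.pos-* 2 m))))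

    module LowerBound {α : ℕ} (α-max : ∀ S → Independent ends S → ∣ S ∣ ℕ.≤ α)
                      (D : Divisor Ĝ) (rank : RankAtLeast Ĝ D 1) where

      open RankOne Ĝ loopless D rank

      gonality≤M : + (4 ℕ.* n ℕ.+ m ℕ.+ 1) - + α ≤ + M
      gonality≤M = ≤-by-slack (+ α + + m - + n + + 1) (ℤ.+-mono-≤ (ℤ.i≤j⇒0≤j-i n≤α+m) (ℤ.+≤+ ℕ.z≤n))
        (trans (cong (_+ (+ α + + m - + n + + 1)) (ℕ→ℤ-gonality α)) (trans (slack (+ n) (+ m) (+ α)) (sym ℕ→ℤ-M)))
        where
        n≤α+m : + n ≤ + α + + m
        n≤α+m = subst₂ (λ a b → a ≤ + α + b) (Σℤ-1 n) (Σℤ-1 m) (count≤α+inner-edges α-max (λ _ → true))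
        slack : ∀ n m a → + 4 * n + m + + 1 - a + (a + m - n + + 1) ≡ + 3 * n + + 2 * m + + 2
        slack = solve-∀

      module Small (deg<M : Σℤ F₀ < + M) where

        flat : ∀ q → Flat (firing q)
        flat q = flat-if-small (λ u → ℤ.≤-trans (ℤ.i≤j+i _ (indicator q u)) (indicator+laplace≤F₀ q u))
                               F₀-effective deg<M

        Qx : Fin (hatN n m) → Node → ℤ
        Qx q = flatLaplace (firing q ⌜ T ⌝) (λ v → firing q ⌜ V v ⌝)

        F₀≥χ+Qx : ∀ q s → indicator q ⌜ s ⌝ + Qx q s ≤ F₀ ⌜ s ⌝
        F₀≥χ+Qx q s = subst (λ l → indicator q ⌜ s ⌝ + l ≤ F₀ ⌜ s ⌝) (laplace-flat (flat q) s)
                            (indicator+laplace≤F₀ q ⌜ s ⌝)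

        F₀≥1+Qx : ∀ s → + 1 + Qx ⌜ s ⌝ s ≤ F₀ ⌜ s ⌝
        F₀≥1+Qx s = subst (λ c → c + Qx ⌜ s ⌝ s ≤ F₀ ⌜ s ⌝) (indicator-self ⌜ s ⌝) (F₀≥χ+Qx ⌜ s ⌝ s)

        F₀≥Qx : ∀ q s → Qx q s ≤ F₀ ⌜ s ⌝
        F₀≥Qx q s = ℤ.≤-trans (ℤ.i≤j+i _ (indicator q ⌜ s ⌝)) (F₀≥χ+Qx q s)

        private
          antisymmetric : ∀ a b → a - b ≡ - (b - a)
          antisymmetric = solve-∀

        δ : Fin (hatN n m) → Fin n → ℤ
        δ q v = firing q ⌜ V v ⌝ - firing q ⌜ T ⌝

        gadgetMass : Fin n → ℤ
        gadgetMass v = F₀ ⌜ V′ v ⌝ + F₀ ⌜ Tᵥ v ⌝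

        edgeMass : Fin m → ℤ
        edgeMass e = F₀ ⌜ E₁ e ⌝ + F₀ ⌜ E₂ e ⌝

        light? : Fin n → Bool
        light? v = does (gadgetMass v ℤ.≤? + 2)

        -- F₀(v′) ≥ 3δ and F₀(Tᵥ) ≥ -3δ, so a gadget of mass ≤ 2 forces δ = 0.
        δ≡0 : ∀ v → gadgetMass v ≤ + 2 → ∀ q → δ q v ≡ + 0
        δ≡0 v mass≤2 q = 3*i≤2⇒3*-i≤2⇒i≡0 (δ q v)
          (ℤ.≤-trans (F₀≥Qx q (V′ v)) (ℤ.≤-trans V′≤mass mass≤2))
          (subst (_≤ + 2) (cong (+ 3 *_) (antisymmetric (firing q ⌜ T ⌝) (firing q ⌜ V v ⌝)))
                 (ℤ.≤-trans (F₀≥Qx q (Tᵥ v)) (ℤ.≤-trans Tᵥ≤mass mass≤2)))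
          where
          V′≤mass : F₀ ⌜ V′ v ⌝ ≤ gadgetMass v
          V′≤mass = ℤ.i≤i+j _ _ {{ℤ.nonNegative (F₀-effective ⌜ Tᵥ v ⌝)}}
          Tᵥ≤mass : F₀ ⌜ Tᵥ v ⌝ ≤ gadgetMass v
          Tᵥ≤mass = ℤ.i≤j+i _ _ {{ℤ.nonNegative (F₀-effective ⌜ V′ v ⌝)}}

        gadgetMass-bound : ∀ v → + 3 ≤ gadgetMass v + + ind (light? v)
        gadgetMass-bound v with gadgetMass v ℤ.≤? + 2
        ... | no  ≰2 = subst (+ 3 ≤_) (sym (ℤ.+-identityʳ _)) (ℤ.i<j⇒suc[i]≤j (ℤ.≰⇒> ≰2))
        ... | yes ≤2 = ℤ.+-monoˡ-≤ (+ 1) (ℤ.+-mono-≤ V′≥1 Tᵥ≥1)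
          where
          V′≥1 : + 1 ≤ F₀ ⌜ V′ v ⌝
          V′≥1 = subst (λ d → + 1 + + 3 * d ≤ F₀ ⌜ V′ v ⌝) (δ≡0 v ≤2 ⌜ V′ v ⌝) (F₀≥1+Qx (V′ v))
          Tᵥ≥1 : + 1 ≤ F₀ ⌜ Tᵥ v ⌝
          Tᵥ≥1 = subst (λ d → + 1 + + 3 * d ≤ F₀ ⌜ Tᵥ v ⌝)
                       (trans (antisymmetric (firing ⌜ Tᵥ v ⌝ ⌜ T ⌝) (firing ⌜ Tᵥ v ⌝ ⌜ V v ⌝))
                              (cong -_ (δ≡0 v ≤2 ⌜ Tᵥ v ⌝)))
                       (F₀≥1+Qx (Tᵥ v))

        edgeMass≥1 : ∀ e → + 1 ≤ edgeMass e
        edgeMass≥1 e = subst (_≤ edgeMass e) (cancel (+ 1) (firing q ⌜ V (end₁ e) ⌝) (firing q ⌜ V (end₂ e) ⌝))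
                             (ℤ.+-mono-≤ (F₀≥1+Qx (E₁ e)) (F₀≥Qx q (E₂ e)))
          where
          q = ⌜ E₁ e ⌝
          cancel : ∀ c a b → c + (a - b) + (b - a) ≡ c
          cancel = solve-∀

        level : ∀ q {a b} → δ q a ≡ + 0 → δ q b ≡ + 0 → firing q ⌜ V a ⌝ - firing q ⌜ V b ⌝ ≡ + 0
        level q {a} {b} δa≡0 δb≡0 = trans (shift (firing q ⌜ V a ⌝) (firing q ⌜ V b ⌝) (firing q ⌜ T ⌝))
                                          (cong₂ _-_ δa≡0 δb≡0)
          where
          shift : ∀ a b t → a - b ≡ (a - t) - (b - t)
          shift = solve-∀

        edgeMass-bound : ∀ e → + 1 + + ind (light? (end₁ e) ∧ light? (end₂ e)) ≤ edgeMass e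
        edgeMass-bound e with gadgetMass (end₁ e) ℤ.≤? + 2 | gadgetMass (end₂ e) ℤ.≤? + 2
        ... | yes ≤2₁ | yes ≤2₂ = ℤ.+-mono-≤
          (subst (λ d → + 1 + d ≤ F₀ ⌜ E₁ e ⌝) (level ⌜ E₁ e ⌝ (δ≡0 _ ≤2₁ ⌜ E₁ e ⌝) (δ≡0 _ ≤2₂ ⌜ E₁ e ⌝))
                 (F₀≥1+Qx (E₁ e)))
          (subst (λ d → + 1 + d ≤ F₀ ⌜ E₂ e ⌝) (level ⌜ E₂ e ⌝ (δ≡0 _ ≤2₂ ⌜ E₂ e ⌝) (δ≡0 _ ≤2₁ ⌜ E₂ e ⌝))
                 (F₀≥1+Qx (E₂ e)))
        ... | yes _ | no _  = edgeMass≥1 e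
        ... | no _  | _     = edgeMass≥1 e

        private
          combine : ∀ {t v g s e k n m a} → + 1 ≤ t → n ≤ v → + 3 * n ≤ g + s → m + k ≤ e → s ≤ a + k →
                    + 4 * n + m + + 1 - a ≤ t + v + g + e
          combine {t} {v} {g} {s} {e} {k} {n} {m} {a} hT hV hG hE hS = ≤-by-slack _
            (ℤ.+-mono-≤ (ℤ.+-mono-≤ (ℤ.+-mono-≤ (ℤ.+-mono-≤ (ℤ.i≤j⇒0≤j-i hT) (ℤ.i≤j⇒0≤j-i hV))
                                                  (ℤ.i≤j⇒0≤j-i hG)) (ℤ.i≤j⇒0≤j-i hE)) (ℤ.i≤j⇒0≤j-i hS))
            (slack t v g s e k n m a)
            where
            slack : ∀ t v g s e k n m a →
                    + 4 * n + m + + 1 - a + ((t - + 1) + (v - n) + (g + s - + 3 * n) + (e - (m + k)) + (a + k - s))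
                    ≡ t + v + g + e
            slack = solve-∀

        deg-F₀-bound : + (4 ℕ.* n ℕ.+ m ℕ.+ 1) - + α ≤ Σℤ F₀
        deg-F₀-bound = subst₂ _≤_ (sym (ℕ→ℤ-gonality α)) (sym (Σℤ-Ĝ-grouped F₀))
          (combine {k = light-edges} (F₀≥1+Qx T) V-bound gadgetMasses-bound edgeMasses-bound (count≤α+inner-edges α-max light?))
          where
          light-edges : ℤ
          light-edges = Σℤ (λ e → + ind (light? (end₁ e) ∧ light? (end₂ e)))
          V-bound : + n ≤ Σℤ (λ v → F₀ ⌜ V v ⌝)
          V-bound = subst (_≤ Σℤ (λ v → F₀ ⌜ V v ⌝)) (Σℤ-1 n) (Σℤ-mono-≤ (λ v → F₀≥1+Qx (V v)))
          gadgetMasses-bound : + 3 * + n ≤ Σℤ gadgetMass + Σℤ (λ v → + ind (light? v))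
          gadgetMasses-bound = subst₂ _≤_ (trans (Σℤ-const n 3) (trans (ℤ.pos-* n 3) (ℤ.*-comm (+ n) (+ 3))))
                                     (Σℤ-+ gadgetMass (λ v → + ind (light? v))) (Σℤ-mono-≤ gadgetMass-bound)
          edgeMasses-bound : + m + light-edges ≤ Σℤ edgeMass
          edgeMasses-bound = subst (_≤ Σℤ edgeMass)
            (trans (Σℤ-+ (λ _ → + 1) (λ e → + ind (light? (end₁ e) ∧ light? (end₂ e)))) (cong (_+ light-edges) (Σℤ-1 m)))
            (Σℤ-mono-≤ edgeMass-bound)

      lower-bound : + (4 ℕ.* n ℕ.+ m ℕ.+ 1) - + α ≤ deg {Ĝ} D
      lower-bound with Σℤ F₀ ℤ.<? + M
      ... | yes deg<M = subst (_ ≤_) (sym deg-D) (Small.deg-F₀-bound deg<M)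
      ... | no  deg≮M = subst (_ ≤_) (sym deg-D) (ℤ.≤-trans gonality≤M (ℤ.≮⇒≥ deg≮M))


    module UpperBound (distinct-ends : ∀ e → ¬ end₁ e ≡ end₂ e) {α : ℕ}
                      (I : Subset n) (I-independent : Independent ends I) (∣I∣≡α : ∣ I ∣ ≡ α) where

      inI : Fin n → Bool
      inI = lookup I

      -- e is oriented from end₁ e to end₂ e (its chip sits on E₁): into I if it meets I, by index otherwise.
      chipAtE₁ : Fin m → Bool
      chipAtE₁ e = not (inI (end₁ e)) ∧ (inI (end₂ e) ∨ does (end₁ e Fin.<? end₂ e))

      chips : Node → ℤ
      chips T      = + 1
      chips (V v)  = + 1
      chips (V′ v) = if inI v then + 1 else + 3
      chips (Tᵥ v) = if inI v then + 1 else + 0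
      chips (E₁ e) = + ind (chipAtE₁ e)
      chips (E₂ e) = + ind (not (chipAtE₁ e))

      D : Divisor Ĝ
      D u = chips (decode u)

      D-⌜⌝ : ∀ s → D ⌜ s ⌝ ≡ chips s
      D-⌜⌝ s = cong chips (decode-⌜⌝ s)

      deg-D : deg {Ĝ} D ≡ + (4 ℕ.* n ℕ.+ m ℕ.+ 1) - + α
      deg-D = begin
        Σℤ D
          ≡⟨ Σℤ-Ĝ-grouped D ⟩
        + 1 + Σℤ (λ v → D ⌜ V v ⌝) + Σℤ (λ v → D ⌜ V′ v ⌝ + D ⌜ Tᵥ v ⌝)
            + Σℤ (λ e → D ⌜ E₁ e ⌝ + D ⌜ E₂ e ⌝)
          ≡⟨ cong₂ _+_ (cong₂ (λ a b → + 1 + a + b) V-sum gadget-sum) edge-sum ⟩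
        + 1 + + n + (+ 3 * + n - + α) + + m
          ≡⟨ rearrange (+ n) (+ m) (+ α) ⟩
        + 4 * + n + + m + + 1 - + α
          ≡⟨ sym (ℕ→ℤ-gonality α) ⟩
        + (4 ℕ.* n ℕ.+ m ℕ.+ 1) - + α ∎
        where
        open ≡-Reasoning
        rearrange : ∀ n m a → + 1 + n + (+ 3 * n - a) + m ≡ + 4 * n + m + + 1 - a
        rearrange = solve-∀
        V-sum : Σℤ (λ v → D ⌜ V v ⌝) ≡ + n
        V-sum = trans (Σℤ-cong (λ v → D-⌜⌝ (V v))) (Σℤ-1 n)
        gadget-chips : ∀ b → (if b then + 1 else + 3) + (if b then + 1 else + 0) ≡ + 3 - + ind b
        gadget-chips true  = refl
        gadget-chips false = refl
        gadget-sum : Σℤ (λ v → D ⌜ V′ v ⌝ + D ⌜ Tᵥ v ⌝) ≡ + 3 * + n - + α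
        gadget-sum = begin
          Σℤ (λ v → D ⌜ V′ v ⌝ + D ⌜ Tᵥ v ⌝)
            ≡⟨ Σℤ-cong (λ v → trans (cong₂ _+_ (D-⌜⌝ (V′ v)) (D-⌜⌝ (Tᵥ v))) (gadget-chips (inI v))) ⟩
          Σℤ (λ v → + 3 - + ind (inI v))
            ≡⟨ Σℤ-- (λ _ → + 3) (λ v → + ind (inI v)) ⟩
          Σℤ {n} (λ _ → + 3) - Σℤ (λ v → + ind (inI v))
            ≡⟨ cong₂ _-_ (trans (Σℤ-const n 3) (trans (ℤ.pos-* n 3) (ℤ.*-comm (+ n) (+ 3))))
                         (trans (Σℤ-∣∣ I) (cong +_ ∣I∣≡α)) ⟩
          + 3 * + n - + α ∎
        edge-chips : ∀ b → + ind b + + ind (not b) ≡ + 1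
        edge-chips true  = refl
        edge-chips false = refl
        edge-sum : Σℤ (λ e → D ⌜ E₁ e ⌝ + D ⌜ E₂ e ⌝) ≡ + m
        edge-sum = trans (Σℤ-cong (λ e → trans (cong₂ _+_ (D-⌜⌝ (E₁ e)) (D-⌜⌝ (E₂ e))) (edge-chips (chipAtE₁ e))))
                         (Σℤ-1 m)

      fire : (Fin n → Bool) → Divisor Ĝ
      fire X = extend (+ 0) (λ v → + ind (X v))

      fired : (Fin n → Bool) → Node → ℤ
      fired X s = chips s - flatLaplace (+ 0) (λ v → + ind (X v)) s

      fired-⌜⌝ : ∀ X s → D ⌜ s ⌝ - laplace Ĝ (fire X) ⌜ s ⌝ ≡ fired X s
      fired-⌜⌝ X s = cong₂ _-_ (D-⌜⌝ s) (laplace-extend (+ 0) (λ v → + ind (X v)) s)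

      record Admissible (X : Fin n → Bool) : Set where
        field
          avoids-I : ∀ v → X v ≡ true → inI v ≡ false
          leaves₁  : ∀ e → X (end₁ e) ≡ true → X (end₂ e) ≡ false → chipAtE₁ e ≡ true
          leaves₂  : ∀ e → X (end₂ e) ≡ true → X (end₁ e) ≡ false → chipAtE₁ e ≡ false

      private
        V′-effective : ∀ i x → (x ≡ true → i ≡ false) → + 0 ≤ (if i then + 1 else + 3) - + 3 * (+ ind x - + 0)
        V′-effective i     true  x⇒¬i rewrite x⇒¬i refl = ℤ.≤-refl
        V′-effective true  false _ = ℤ.+≤+ ℕ.z≤n
        V′-effective false false _ = ℤ.+≤+ ℕ.z≤n

        Tᵥ-effective : ∀ i x → + 0 ≤ (if i then + 1 else + 0) - + 3 * (+ 0 - + ind x)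
        Tᵥ-effective true  true  = ℤ.+≤+ ℕ.z≤n
        Tᵥ-effective true  false = ℤ.+≤+ ℕ.z≤n
        Tᵥ-effective false true  = ℤ.+≤+ ℕ.z≤n
        Tᵥ-effective false false = ℤ.≤-refl

        E-effective : ∀ c x₁ x₂ → (x₁ ≡ true → x₂ ≡ false → c ≡ true) → + 0 ≤ + ind c - (+ ind x₁ - + ind x₂)
        E-effective c     true  false x⇒c rewrite x⇒c refl refl = ℤ.≤-refl
        E-effective true  true  true  _ = ℤ.+≤+ ℕ.z≤n
        E-effective false true  true  _ = ℤ.≤-refl
        E-effective true  false true  _ = ℤ.+≤+ ℕ.z≤n
        E-effective false false true  _ = ℤ.+≤+ ℕ.z≤n
        E-effective true  false false _ = ℤ.+≤+ ℕ.z≤n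
        E-effective false false false _ = ℤ.≤-refl

      fired-effective : ∀ {X} → Admissible X → ∀ s → + 0 ≤ fired X s
      fired-effective adm T      = ℤ.+≤+ ℕ.z≤n
      fired-effective adm (V v)  = ℤ.+≤+ ℕ.z≤n
      fired-effective {X} adm (V′ v) = V′-effective (inI v) (X v) (Admissible.avoids-I adm v)
      fired-effective {X} adm (Tᵥ v) = Tᵥ-effective (inI v) (X v)
      fired-effective {X} adm (E₁ e) = E-effective (chipAtE₁ e) (X (end₁ e)) (X (end₂ e)) (Admissible.leaves₁ adm e)
      fired-effective {X} adm (E₂ e) = E-effective (not (chipAtE₁ e)) (X (end₂ e)) (X (end₁ e))
                                                   (λ x₂ ¬x₁ → cong not (Admissible.leaves₂ adm e x₂ ¬x₁))

      private
        does-true : ∀ {A : Set} (a? : Dec A) → does a? ≡ true → A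
        does-true (yes a) _ = a

        does-false : ∀ {A : Set} (a? : Dec A) → does a? ≡ false → ¬ A
        does-false (no ¬a) _ = ¬a

      ∅-admissible : Admissible (λ _ → false)
      ∅-admissible = record { avoids-I = λ _ () ; leaves₁ = λ _ () ; leaves₂ = λ _ () }

      prefix : Fin n → Fin n → Bool
      prefix k v = not (inI v) ∧ does (v Fin.≤? k)

      prefix-admissible : ∀ k → Admissible (prefix k)
      prefix-admissible k = record { avoids-I = avoids-I ; leaves₁ = leaves₁ ; leaves₂ = leaves₂ }
        where
        avoids-I : ∀ v → prefix k v ≡ true → inI v ≡ false
        avoids-I v _  with inI v
        avoids-I v () | true
        avoids-I v _  | false = refl
        leaves₁ : ∀ e → prefix k (end₁ e) ≡ true → prefix k (end₂ e) ≡ false → chipAtE₁ e ≡ true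
        leaves₁ e x₁ x₂ with inI (end₁ e) | inI (end₂ e)
        leaves₁ e () x₂ | true  | _
        leaves₁ e x₁ x₂ | false | true  = refl
        leaves₁ e x₁ x₂ | false | false = dec-true (end₁ e Fin.<? end₂ e)
          (ℕ.≤-<-trans (does-true (end₁ e Fin.≤? k) x₁) (ℕ.≰⇒> (does-false (end₂ e Fin.≤? k) x₂)))
        leaves₂ : ∀ e → prefix k (end₂ e) ≡ true → prefix k (end₁ e) ≡ false → chipAtE₁ e ≡ false
        leaves₂ e x₂ x₁ with inI (end₁ e) | inI (end₂ e)
        leaves₂ e x₂ x₁ | true  | _     = refl
        leaves₂ e () x₁ | false | true
        leaves₂ e x₂ x₁ | false | false = dec-false (end₁ e Fin.<? end₂ e) (λ a<b →
          ℕ.<-asym a<b (ℕ.≤-<-trans (does-true (end₂ e Fin.≤? k) x₂) (ℕ.≰⇒> (does-false (end₁ e Fin.≤? k) x₁))))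

      prefix-self : ∀ v → inI v ≡ false → prefix v v ≡ true
      prefix-self v v∉I = cong₂ (λ a b → not a ∧ b) v∉I (dec-true (v Fin.≤? v) (Fin.≤-refl {x = v}))

      module _ (e : Fin m) where

        chip⇒end₁∉I : chipAtE₁ e ≡ true → inI (end₁ e) ≡ false
        chip⇒end₁∉I chip with inI (end₁ e)
        chip⇒end₁∉I () | true
        chip⇒end₁∉I _  | false = refl

        chip⇒end₂∉prefix : chipAtE₁ e ≡ true → prefix (end₁ e) (end₂ e) ≡ false
        chip⇒end₂∉prefix chip with inI (end₂ e)
        ... | true  = refl
        ... | false = dec-false (end₂ e Fin.≤? end₁ e)
          (ℕ.<⇒≱ (does-true (end₁ e Fin.<? end₂ e) (Bool.∧-conicalʳ _ _ chip)))

        ¬chip⇒end₂∉I : chipAtE₁ e ≡ false → inI (end₂ e) ≡ false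
        ¬chip⇒end₂∉I ¬chip with inI (end₁ e) in i₁ | inI (end₂ e) in i₂
        ... | _     | false = refl
        ... | true  | true  = ⊥-elim (I-independent e (lookup⇒[]= (end₁ e) I i₁ , lookup⇒[]= (end₂ e) I i₂))
        ¬chip⇒end₂∉I () | false | true

        ¬chip⇒end₁∉prefix : chipAtE₁ e ≡ false → prefix (end₂ e) (end₁ e) ≡ false
        ¬chip⇒end₁∉prefix ¬chip with inI (end₁ e)
        ... | true  = refl
        ... | false = dec-false (end₁ e Fin.≤? end₂ e) (λ a≤b →
          does-false (end₁ e Fin.<? end₂ e) (Bool.∨-conicalʳ _ _ ¬chip) (Fin.≤∧≢⇒< a≤b (distinct-ends e)))

      private
        resting : ∀ {c} → c ≡ true → + 1 ≤ + ind c - (+ 0 - + 0)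
        resting refl = ℤ.≤-refl

        crossing : ∀ {c x₁ x₂} → c ≡ false → x₁ ≡ false → x₂ ≡ true → + 1 ≤ + ind c - (+ ind x₁ - + ind x₂)
        crossing refl refl refl = ℤ.≤-refl

        V′-value : ∀ i → + 1 ≤ (if i then + 1 else + 3) - + 3 * (+ 0 - + 0)
        V′-value true  = ℤ.≤-refl
        V′-value false = ℤ.+≤+ (ℕ.s≤s ℕ.z≤n)

        Tᵥ-resting : ∀ {i} → i ≡ true → + 1 ≤ (if i then + 1 else + 0) - + 3 * (+ 0 - + 0)
        Tᵥ-resting refl = ℤ.≤-refl

        Tᵥ-fired : ∀ {i x} → i ≡ false → x ≡ true → + 1 ≤ (if i then + 1 else + 0) - + 3 * (+ 0 - + ind x)
        Tᵥ-fired refl refl = ℤ.+≤+ (ℕ.s≤s ℕ.z≤n)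

      Witness : Node → Set
      Witness s = ∃ λ X → Admissible X × + 1 ≤ fired X s

      witness : ∀ s → Witness s
      witness T      = (λ _ → false) , ∅-admissible , ℤ.≤-refl
      witness (V v)  = (λ _ → false) , ∅-admissible , ℤ.≤-refl
      witness (V′ v) = (λ _ → false) , ∅-admissible , V′-value (inI v)
      witness (Tᵥ v) = Tᵥ-witness (inI v) refl
        where
        Tᵥ-witness : ∀ b → inI v ≡ b → Witness (Tᵥ v)
        Tᵥ-witness true  v∈I = (λ _ → false) , ∅-admissible , Tᵥ-resting v∈I
        Tᵥ-witness false v∉I = prefix v , prefix-admissible v , Tᵥ-fired v∉I (prefix-self v v∉I)
      witness (E₁ e) = E₁-witness (chipAtE₁ e) refl
        where
        E₁-witness : ∀ b → chipAtE₁ e ≡ b → Witness (E₁ e)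
        E₁-witness true  chip  = (λ _ → false) , ∅-admissible , resting chip
        E₁-witness false ¬chip = prefix (end₂ e) , prefix-admissible (end₂ e) ,
          crossing ¬chip (¬chip⇒end₁∉prefix e ¬chip) (prefix-self (end₂ e) (¬chip⇒end₂∉I e ¬chip))
      witness (E₂ e) = E₂-witness (chipAtE₁ e) refl
        where
        E₂-witness : ∀ b → chipAtE₁ e ≡ b → Witness (E₂ e)
        E₂-witness false ¬chip = (λ _ → false) , ∅-admissible , resting (cong not ¬chip)
        E₂-witness true  chip  = prefix (end₁ e) , prefix-admissible (end₁ e) ,
          crossing (cong not chip) (chip⇒end₂∉prefix e chip) (prefix-self (end₁ e) (chip⇒end₁∉I e chip))

      rank : RankAtLeast Ĝ D 1
      rank = rank≥1 Ĝ D ⌜ T ⌝ (every-node λ s → let (X , admissible , 1≤fired) = witness s in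
        (λ u → D u - laplace Ĝ (fire X) u) ,
        every-node (λ t → subst (+ 0 ≤_) (sym (fired-⌜⌝ X t)) (fired-effective admissible t)) ,
        (fire X , λ u → cancel (D u) (laplace Ĝ (fire X) u)) ,
        subst (+ 1 ≤_) (sym (fired-⌜⌝ X s)) 1≤fired)
        where
        cancel : ∀ d l → d - (d - l) ≡ l
        cancel = solve-∀

open import Data.Nat using (ℕ; _+_; _*_)
open import Data.Integer using (+_; _-_)
open import Data.Fin using (Fin)
open import Data.Product using (_×_; proj₁; proj₂; _,_)
open import Relation.Binary.PropositionalEquality using (_≢_)
open Gonality.HatGraph using (module LowerBound; module UpperBound)

lemma4 : (n m : ℕ) (ends : Fin m → Fin n × Fin n)
         → (∀ e → proj₁ (ends e) ≢ proj₂ (ends e))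
         → (α : ℕ) → IsIndependenceNumber ends α
         → IsGonality (hat n m ends) (+ (4 * n + m + 1) - + α)
lemma4 n m ends distinct-ends α ((I , I-independent , ∣I∣≡α) , α-max) =
  (D , rank , deg-D) , λ D′ rank′ → LowerBound.lower-bound n m ends α-max D′ rank′
  where
  open UpperBound n m ends distinct-ends I I-independent ∣I∣≡α
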